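{- For every integer $k>2$, each of the maps $\mathrm{DM}_6(k)$, $\mathrm{DM}_7(k)$, $\mathrm{DM}_8(k)$ is parallel-product decomposable if and only if $k$ is not a prime power.
   Context: Let $F=\langle t,l,r\mid t^2=l^2=r^2=(tl)^2=1\rangle$. A (finite rooted) map is a quadruple $M=(f,G,Z,\mathrm{id})$, where $Z$ is a finite set of flags, $G=\mathrm{Mon}(M)$ is a group acting on $Z$ on the right, transitively and faithfully, $f:F\to G$ is an epimorphism, and $\mathrm{id}\in Z$ is the root; $T=f(t),L=f(l),R=f(r)$. Isomorphism of maps $(f_1,G_1,Z_1,\mathrm{id}_1)\to(f_2,G_2,Z_2,\mathrm{id}_2)$: a group isomorphism $\psi$ with $\psi\circ f_1=f_2$ and a bijection $\phi$ with $\phi(\mathrm{id}_1)=\mathrm{id}_2$, $\phi(z\cdot g)=\phi(z)\cdot\psi(g)$. For $k\ge1$: $\mathrm{DM}_6(k)$, $\mathrm{DM}_7(k)$, $\mathrm{DM}_8(k)$ are the maps $(f,G,G,1)$ ($G$ acting on itself by right multiplication, $f(t)=T,f(l)=L,f(r)=R$) where $G=\langle T,L,R\mid T^{e_1},L^{e_2},R^{e_3},(TL)^{e_4},(TR)^{e_5},(LR)^{e_6},(TLR)^{e_7}\rangle$ with $(e_1,\dots,e_7)$ equal to $(2,1,2,2,k,2,k)$, $(1,2,2,2,2,k,k)$, $(2,2,2,1,k,k,2)$ respectively (dihedral groups of order $2k$). Parallel product: $M_1\parallel M_2=(f_{1,2},K,X,(\mathrm{id}_1,\mathrm{id}_2))$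 with $f_{1,2}=(f_1,f_2)$, $K=f_{1,2}(F)\le G_1\times G_2$, $X$ the $K$-orbit of $(\mathrm{id}_1,\mathrm{id}_2)$ in $Z_1\times Z_2$. Monodromy quotient: for $H\trianglelefteq G$, $M\triangle H=(q\circ f,G/H,Z/H,[\mathrm{id}])$, $Z/H$ the $H$-orbits, $q$ natural, $[z]\cdot Hg=[z\cdot g]$. $M$ is parallel-product decomposable if there are maps $M_1,M_2$, each isomorphic to a monodromy quotient of $M$, with $M\cong M_1\parallel M_2$ and $M_1\parallel M_2$ isomorphic to neither $M_1$ nor $M_2$. -}

module Defs where

open import Level using (0ℓ) renaming (suc to lsuc)
open import Data.Nat using (ℕ; _<_; _^_)
open import Data.Nat.Primality using (Prime)
open import Data.Fin using (Fin)
open import Data.Bool using (Bool; true; false; not)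
open import Data.List using (List; []; _∷_; _++_; [_]; reverse; map; concat; replicate)
open import Data.List.Membership.Propositional using (_∈_)
open import Data.Product using (Σ; ∃; ∃-syntax; _×_; _,_)
open import Relation.Binary.PropositionalEquality using (_≡_)
open import Relation.Binary.Structures using (IsEquivalence)
open import Relation.Nullary using (¬_)
open import Algebra.Bundles.Raw using (RawGroup)
open import Algebra.Structures using (IsGroup)

-- The group F = < t, l, r | t² = l² = r² = (tl)² = 1 >.
-- Since all generators are involutions, every element of F is the image
-- of a positive word in t, l, r; a homomorphism out of F is determined
-- by the images of t, l, r (which must satisfy the defining relations),
-- and two homomorphisms agree iff they agree on all such words.

data Gen : Set where
  t l r : Gen

FWord : Set
FWord = List Gen

-- Raw data of a (rooted) map: a raw group G, the images T, L, R of
-- t, l, r (i.e. the homomorphism f : F → G), the flag set Z with its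
-- equality, the right action, and the root.

record MapData : Set₁ where
  field
    G : RawGroup 0ℓ 0ℓ
  open RawGroup G public
  field
    T L R : Carrier
    Z     : Set
    _≈Z_  : Z → Z → Set
    _·_   : Z → Carrier → Z
    root  : Z

  gen : Gen → Carrier
  gen t = T
  gen l = L
  gen r = R

  f : FWord → Carrier
  f []      = ε
  f (x ∷ w) = gen x ∙ f w

record IsMap (M : MapData) : Set where
  open MapData M
  field
    isGroup   : IsGroup _≈_ _∙_ ε _⁻¹
    Z-equiv   : IsEquivalence _≈Z_
    ·-cong    : ∀ {z z′ g h} → z ≈Z z′ → g ≈ h → (z · g) ≈Z (z′ · h)
    ·-ε       : ∀ z → (z · ε) ≈Z z
    ·-∙       : ∀ z g h → (z · (g ∙ h)) ≈Z ((z · g) · h)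
    rel-T     : T ∙ T ≈ ε
    rel-L     : L ∙ L ≈ ε
    rel-R     : R ∙ R ≈ ε
    rel-TL    : (T ∙ L) ∙ (T ∙ L) ≈ ε
    f-surj    : ∀ g → ∃[ w ] f w ≈ g
    trans-act : ∀ z z′ → ∃[ g ] (z · g) ≈Z z′
    faithful  : ∀ g → (∀ z → (z · g) ≈Z z) → g ≈ ε
    finite    : ∃[ n ] Σ (Fin n → Z) λ e → ∀ z → ∃[ i ] e i ≈Z z

record _≅_ (M₁ M₂ : MapData) : Set where
  module A = MapData M₁
  module B = MapData M₂
  field
    ψ      : A.Carrier → B.Carrier
    ψ-cong : ∀ {g h} → g A.≈ h → ψ g B.≈ ψ h
    ψ-inj  : ∀ {g h} → ψ g B.≈ ψ h → g A.≈ h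
    ψ-surj : ∀ y → ∃[ x ] ψ x B.≈ y
    ψ-hom  : ∀ g h → ψ (g A.∙ h) B.≈ (ψ g B.∙ ψ h)
    ψ∘f    : ∀ w → ψ (A.f w) B.≈ B.f w
    φ      : A.Z → B.Z
    φ-cong : ∀ {z w} → z A.≈Z w → φ z B.≈Z φ w
    φ-inj  : ∀ {z w} → φ z B.≈Z φ w → z A.≈Z w
    φ-surj : ∀ y → ∃[ x ] φ x B.≈Z y
    φ-root : φ A.root B.≈Z B.root
    φ-equi : ∀ z g → φ (z A.· g) B.≈Z (φ z B.· ψ g)

-- K = f₁,₂(F) ≤ G₁ × G₂ is represented as the image
-- of F (words), two words being equal iff their images in G₁ × G₂ agree.
-- X, the K-orbit of (id₁, id₂), is represented likewise: the word w
-- stands for (id₁ · f₁(w), id₂ · f₂(w)).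

rev : FWord → FWord
rev = reverse

_∥_ : MapData → MapData → MapData
M₁ ∥ M₂ = record
  { G    = record
    { Carrier = FWord
    ; _≈_     = λ u v → (A.f u A.≈ A.f v) × (B.f u B.≈ B.f v)
    ; _∙_     = _++_
    ; ε       = []
    ; _⁻¹     = rev
    }
  ; T    = [ t ]
  ; L    = [ l ]
  ; R    = [ r ]
  ; Z    = FWord
  ; _≈Z_ = λ u v → ((A.root A.· A.f u) A.≈Z (A.root A.· A.f v))
                 × ((B.root B.· B.f u) B.≈Z (B.root B.· B.f v))
  ; _·_  = _++_
  ; root = []
  }
  where
  module A = MapData M₁
  module B = MapData M₂

record IsNormalSubgroup (M : MapData) (H : MapData.Carrier M → Set) : Set where
  open MapData M
  field
    H-resp : ∀ {g h} → g ≈ h → H g → H h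
    H-ε    : H ε
    H-∙    : ∀ {g h} → H g → H h → H (g ∙ h)
    H-⁻¹   : ∀ {g} → H g → H (g ⁻¹)
    H-conj : ∀ g {h} → H h → H ((g ⁻¹ ∙ h) ∙ g)

-- M △ H : group G/H (cosets Hg, Hg = Hh iff g h⁻¹ ∈ H),
-- flags Z/H (H-orbits), [z] · Hg = [z · g].
_△_ : (M : MapData) → (MapData.Carrier M → Set) → MapData
M △ H = record
  { G    = record
    { Carrier = Carrier
    ; _≈_     = λ g h → H (g ∙ h ⁻¹)
    ; _∙_     = _∙_
    ; ε       = ε
    ; _⁻¹     = _⁻¹
    }
  ; T    = T
  ; L    = L
  ; R    = R
  ; Z    = Z
  ; _≈Z_ = λ z w → ∃[ h ] (H h × (z · h) ≈Z w)
  ; _·_  = _·_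
  ; root = root
  }
  where open MapData M

IsMonodromyQuotient : MapData → MapData → Set₁
IsMonodromyQuotient M N = ∃[ H ] (IsNormalSubgroup M H × N ≅ (M △ H))

ParallelProductDecomposable : MapData → Set₁
ParallelProductDecomposable M =
  Σ MapData λ M₁ → Σ MapData λ M₂ →
    IsMap M₁ × IsMap M₂ ×
    IsMonodromyQuotient M M₁ × IsMonodromyQuotient M M₂ ×
    (M ≅ (M₁ ∥ M₂)) ×
    ¬ ((M₁ ∥ M₂) ≅ M₁) × ¬ ((M₁ ∥ M₂) ≅ M₂)

Letter : Set
Letter = Gen × Bool       -- (x , true) = x, (x , false) = x⁻¹

inv : Letter → Letter
inv (x , b) = x , not b

PWord : Set
PWord = List Letter

pinv : PWord → PWord
pinv w = reverse (map inv w)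

_^w_ : PWord → ℕ → PWord
w ^w n = concat (replicate n w)

data PresEq (rels : List PWord) : PWord → PWord → Set where
  pe-refl  : ∀ {u} → PresEq rels u u
  pe-sym   : ∀ {u v} → PresEq rels u v → PresEq rels v u
  pe-trans : ∀ {u v w} → PresEq rels u v → PresEq rels v w → PresEq rels u w
  pe-free  : ∀ u v x → PresEq rels (u ++ x ∷ inv x ∷ v) (u ++ v)
  pe-rel   : ∀ u v {ρ} → ρ ∈ rels → PresEq rels (u ++ ρ ++ v) (u ++ v)

DMrels : (e₁ e₂ e₃ e₄ e₅ e₆ e₇ : ℕ) → List PWord
DMrels e₁ e₂ e₃ e₄ e₅ e₆ e₇ =
    (T′ ^w e₁) ∷ (L′ ^w e₂) ∷ (R′ ^w e₃) ∷ ((T′ ++ L′) ^w e₄)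
  ∷ ((T′ ++ R′) ^w e₅) ∷ ((L′ ++ R′) ^w e₆) ∷ ((T′ ++ L′ ++ R′) ^w e₇) ∷ []
  where
  T′ L′ R′ : PWord
  T′ = [ (t , true) ]
  L′ = [ (l , true) ]
  R′ = [ (r , true) ]

-- The map (f, G, G, 1) with G the presented group, acting on itself
-- by right multiplication.
DM : (e₁ e₂ e₃ e₄ e₅ e₆ e₇ : ℕ) → MapData
DM e₁ e₂ e₃ e₄ e₅ e₆ e₇ = record
  { G    = record
    { Carrier = PWord
    ; _≈_     = PresEq rels
    ; _∙_     = _++_
    ; ε       = []
    ; _⁻¹     = pinv
    }
  ; T    = [ (t , true) ]
  ; L    = [ (l , true) ]
  ; R    = [ (r , true) ]
  ; Z    = PWord
  ; _≈Z_ = PresEq rels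
  ; _·_  = _++_
  ; root = []
  }
  where rels = DMrels e₁ e₂ e₃ e₄ e₅ e₆ e₇

DM₆ DM₇ DM₈ : ℕ → MapData
DM₆ k = DM 2 1 2 2 k 2 k
DM₇ k = DM 1 2 2 2 2 k k
DM₈ k = DM 2 2 2 1 k k 2

IsPrimePower : ℕ → Set
IsPrimePower n = ∃[ p ] ∃[ m ] (Prime p × 0 < m × n ≡ p ^ m)

-- A map whose flags are the elements of its monodromy group G, acted on by right
-- multiplication (a regular map), has as monodromy quotients exactly the quotients M △ H by
-- normal subgroups H, and the parallel product of M △ H₁ and M △ H₂ is M △ (H₁ ∩ H₂). Hence
-- M is parallel-product decomposable iff G has two normal subgroups with trivial
-- intersection, neither contained in the other.
--
-- Each DMᵢ(k) is regular, and a normal form for its presentation identifies its monodromy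
-- group with the dihedral group Dₖ. If k = mn with coprime m, n > 1, the kernels of Dₖ → Dₘ
-- and Dₖ → Dₙ form such a pair. If k = p^(e+1), every nontrivial normal subgroup of Dₖ
-- contains ρ^(p^e): a reflection s yields s · ρ⁻¹sρ = ρ², and a rotation ρʲ ≠ 1 yields
-- ρ^(p^e) because gcd(j, k) is a proper divisor of k and hence divides p^e.

module Submission where

open import Defs
open import Data.Nat using (ℕ; _<_)
open import Data.Product using (_×_)
open import Function.Bundles using (_⇔_)
open import Relation.Nullary using (¬_)

open import Level using (0ℓ)
open import Algebra.Bundles using (Group)
open import Algebra.Bundles.Raw using (RawGroup)
open import Algebra.Structures using (IsGroup)
open import Algebra.Morphism.Structures using (IsGroupHomomorphism)
import Algebra.Properties.Group as GroupProperties
open import Data.Fin using (Fin)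
open import Data.List using (List; []; _∷_; _++_; [_])
open import Data.Product using (Σ; ∃-syntax; _,_; proj₁; proj₂)
open import Data.Product.Function.NonDependent.Propositional using (_×-⇔_)
open import Function.Bundles using (mk⇔; Equivalence)
import Function.Properties.Equivalence as ⇔
open import Relation.Binary.Definitions using (_Respects_)
open import Relation.Binary.PropositionalEquality as ≡ using (_≡_)
open import Relation.Binary.Structures using (IsEquivalence)
import Relation.Binary.Reasoning.Setoid as SetoidReasoning
open import Relation.Unary using (Pred; _⊆_; _∩_)

open Equivalence using (to; from)

SameElement : MapData → FWord → FWord → Set
SameElement M u v = f u ≈ f v
  where open MapData M

SameFlag : MapData → FWord → FWord → Set
SameFlag M u v = (root · f u) ≈Z (root · f v)
  where open MapData M

f-∥ : ∀ M₁ M₂ w → MapData.f (M₁ ∥ M₂) w ≡ w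
f-∥ M₁ M₂ []      = ≡.refl
f-∥ M₁ M₂ (t ∷ w) = ≡.cong (t ∷_) (f-∥ M₁ M₂ w)
f-∥ M₁ M₂ (l ∷ w) = ≡.cong (l ∷_) (f-∥ M₁ M₂ w)
f-∥ M₁ M₂ (r ∷ w) = ≡.cong (r ∷_) (f-∥ M₁ M₂ w)

f-△ : ∀ M H w → MapData.f (M △ H) w ≡ MapData.f M w
f-△ M H []      = ≡.refl
f-△ M H (t ∷ w) = ≡.cong (MapData._∙_ M (MapData.T M)) (f-△ M H w)
f-△ M H (l ∷ w) = ≡.cong (MapData._∙_ M (MapData.L M)) (f-△ M H w)
f-△ M H (r ∷ w) = ≡.cong (MapData._∙_ M (MapData.R M)) (f-△ M H w)

SameElement-∥ : ∀ M₁ M₂ u v →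
  SameElement (M₁ ∥ M₂) u v ⇔ (SameElement M₁ u v × SameElement M₂ u v)
SameElement-∥ M₁ M₂ u v =
  ≡.subst₂ (λ u′ v′ → SameElement (M₁ ∥ M₂) u v ⇔ MapData._≈_ (M₁ ∥ M₂) u′ v′)
    (f-∥ M₁ M₂ u) (f-∥ M₁ M₂ v) ⇔.refl

SameFlag-∥ : ∀ M₁ M₂ u v →
  SameFlag (M₁ ∥ M₂) u v ⇔ (SameFlag M₁ u v × SameFlag M₂ u v)
SameFlag-∥ M₁ M₂ u v =
  ≡.subst₂ (λ u′ v′ → SameFlag (M₁ ∥ M₂) u v ⇔ MapData._≈Z_ (M₁ ∥ M₂) u′ v′)
    (f-∥ M₁ M₂ u) (f-∥ M₁ M₂ v) ⇔.refl

module MapProperties {M : MapData} (isMap : IsMap M) where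
  open MapData M
  open IsMap isMap
  open IsGroup isGroup
  module Zₑ = IsEquivalence Z-equiv

  f-homo : ∀ u v → f (u ++ v) ≈ f u ∙ f v
  f-homo []      v = sym (identityˡ (f v))
  f-homo (x ∷ u) v = trans (∙-congˡ (f-homo u v)) (sym (assoc (gen x) (f u) (f v)))

  root·f-homo : ∀ u v → (root · f (u ++ v)) ≈Z ((root · f u) · f v)
  root·f-homo u v = Zₑ.trans (·-cong Zₑ.refl (f-homo u v)) (·-∙ root (f u) (f v))

≈-isEquivalence : ∀ {N} → IsMap N → IsEquivalence (MapData._≈_ N)
≈-isEquivalence isMap = IsGroup.isEquivalence (IsMap.isGroup isMap)

∥-isEquivalence : ∀ {M₁ M₂} → IsMap M₁ → IsMap M₂ → IsEquivalence (MapData._≈_ (M₁ ∥ M₂))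
∥-isEquivalence isMap₁ isMap₂ = record
  { refl  = E₁.refl , E₂.refl
  ; sym   = λ (p , q) → E₁.sym p , E₂.sym q
  ; trans = λ (p , q) (p′ , q′) → E₁.trans p p′ , E₂.trans q q′
  }
  where
  module E₁ = IsEquivalence (≈-isEquivalence isMap₁)
  module E₂ = IsEquivalence (≈-isEquivalence isMap₂)

≅-refl : ∀ {N} → IsMap N → N ≅ N
≅-refl isMap = record
  { ψ = λ g → g ; ψ-cong = λ p → p ; ψ-inj = λ p → p ; ψ-surj = λ g → g , refl
  ; ψ-hom = λ _ _ → refl ; ψ∘f = λ _ → refl
  ; φ = λ z → z ; φ-cong = λ p → p ; φ-inj = λ p → p ; φ-surj = λ z → z , Zₑ.refl
  ; φ-root = Zₑ.refl ; φ-equi = λ _ _ → Zₑ.refl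
  }
  where
  open IsMap isMap
  open IsGroup isGroup using (refl)
  module Zₑ = IsEquivalence Z-equiv

≅-sym : ∀ {M N} → IsMap N → M ≅ N → N ≅ M
≅-sym isMap M≅N = record
  { ψ      = ψ⁻¹
  ; ψ-cong = λ p → ψ-inj (trans (ψψ⁻¹ _) (trans p (sym (ψψ⁻¹ _))))
  ; ψ-inj  = λ p → trans (sym (ψψ⁻¹ _)) (trans (ψ-cong p) (ψψ⁻¹ _))
  ; ψ-surj = λ g → ψ g , ψ-inj (ψψ⁻¹ (ψ g))
  ; ψ-hom  = λ g h → ψ-inj (trans (ψψ⁻¹ _)
               (trans (∙-cong (sym (ψψ⁻¹ g)) (sym (ψψ⁻¹ h))) (sym (ψ-hom _ _))))
  ; ψ∘f    = λ w → ψ-inj (trans (ψψ⁻¹ _) (sym (ψ∘f w)))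
  ; φ      = φ⁻¹
  ; φ-cong = λ p → φ-inj (Zₑ.trans (φφ⁻¹ _) (Zₑ.trans p (Zₑ.sym (φφ⁻¹ _))))
  ; φ-inj  = λ p → Zₑ.trans (Zₑ.sym (φφ⁻¹ _)) (Zₑ.trans (φ-cong p) (φφ⁻¹ _))
  ; φ-surj = λ z → φ z , φ-inj (φφ⁻¹ (φ z))
  ; φ-root = φ-inj (Zₑ.trans (φφ⁻¹ _) (Zₑ.sym φ-root))
  ; φ-equi = λ z g → φ-inj (Zₑ.trans (φφ⁻¹ _)
               (Zₑ.trans (·-cong (Zₑ.sym (φφ⁻¹ z)) (sym (ψψ⁻¹ g))) (Zₑ.sym (φ-equi _ _))))
  }
  where
  open _≅_ M≅N
  open IsMap isMap
  open IsGroup isGroup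
  module Zₑ = IsEquivalence Z-equiv

  ψ⁻¹ : B.Carrier → A.Carrier
  ψ⁻¹ g = proj₁ (ψ-surj g)

  ψψ⁻¹ : ∀ g → ψ (ψ⁻¹ g) B.≈ g
  ψψ⁻¹ g = proj₂ (ψ-surj g)

  φ⁻¹ : B.Z → A.Z
  φ⁻¹ z = proj₁ (φ-surj z)

  φφ⁻¹ : ∀ z → φ (φ⁻¹ z) B.≈Z z
  φφ⁻¹ z = proj₂ (φ-surj z)

module _ {M N : MapData} (M≅N : M ≅ N) where
  open _≅_ M≅N

  ≅-SameElement : IsEquivalence (MapData._≈_ N) →
                  ∀ u v → SameElement M u v ⇔ SameElement N u v
  ≅-SameElement ≈-equiv u v = mk⇔
    (λ p → trans (sym (ψ∘f u)) (trans (ψ-cong p) (ψ∘f v)))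
    (λ p → ψ-inj (trans (ψ∘f u) (trans p (sym (ψ∘f v)))))
    where open IsEquivalence ≈-equiv

  ≅-SameFlag : IsMap N → ∀ u v → SameFlag M u v ⇔ SameFlag N u v
  ≅-SameFlag isMap u v = mk⇔
    (λ p → trans (sym (φ-flag u)) (trans (φ-cong p) (φ-flag v)))
    (λ p → φ-inj (trans (φ-flag u) (trans p (sym (φ-flag v)))))
    where
    open IsMap isMap
    open IsEquivalence Z-equiv
    φ-flag : ∀ w → B._≈Z_ (φ (A.root A.· A.f w)) (B.root B.· B.f w)
    φ-flag w = trans (φ-equi A.root (A.f w)) (·-cong φ-root (ψ∘f w))

∥-≅ : ∀ {M₁ M₂ N} → IsMap N →
      (∀ u v → (SameElement M₁ u v × SameElement M₂ u v) ⇔ SameElement N u v) →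
      (∀ u v → (SameFlag M₁ u v × SameFlag M₂ u v) ⇔ SameFlag N u v) →
      (M₁ ∥ M₂) ≅ N
∥-≅ {M₁} {M₂} {N} isMap sameElement sameFlag = record
  { ψ      = f
  ; ψ-cong = λ {u} {v} → to (sameElement u v)
  ; ψ-inj  = λ {u} {v} → from (sameElement u v)
  ; ψ-surj = f-surj
  ; ψ-hom  = f-homo
  ; ψ∘f    = λ w → reflexive (≡.cong f (f-∥ M₁ M₂ w))
  ; φ      = λ w → root · f w
  ; φ-cong = λ {u} {v} → to (sameFlag u v)
  ; φ-inj  = λ {u} {v} → from (sameFlag u v)
  ; φ-surj = λ z → let (g , root·g≈z) = trans-act root z ; (w , fw≈g) = f-surj g
                   in w , Zₑ.trans (·-cong Zₑ.refl fw≈g) root·g≈z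
  ; φ-root = ·-ε root
  ; φ-equi = root·f-homo
  }
  where
  open MapData N
  open IsMap isMap
  open IsGroup isGroup using (reflexive)
  open MapProperties isMap

regular : (G : RawGroup 0ℓ 0ℓ) (T L R : RawGroup.Carrier G) → MapData
regular G T L R = record
  { G = G ; T = T ; L = L ; R = R
  ; Z = Carrier ; _≈Z_ = _≈_ ; _·_ = _∙_ ; root = ε }
  where open RawGroup G

module Regular (G : Group 0ℓ 0ℓ) (T L R : Group.Carrier G) where
  open Group G
  open GroupProperties G

  M : MapData
  M = regular rawGroup T L R

  open MapData M using (f)

  record HasKernel (N : MapData) (K : Pred Carrier 0ℓ) : Set where
    field
      sameElement : ∀ u v → SameElement N u v ⇔ K (f u // f v)
      sameFlag    : ∀ u v → SameFlag N u v ⇔ K (f u // f v)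

  regular-HasKernel : HasKernel M (_≈ ε)
  regular-HasKernel = record
    { sameElement = λ u v → mk⇔ x≈y⇒x∙y⁻¹≈ε (x∙y⁻¹≈ε⇒x≈y _ _)
    ; sameFlag    = λ u v → mk⇔
        (λ p → x≈y⇒x∙y⁻¹≈ε (trans (sym (identityˡ _)) (trans p (identityˡ _))))
        (λ p → ∙-congˡ (x∙y⁻¹≈ε⇒x≈y _ _ p))
    }

  ≅-HasKernel : ∀ {N N′ K} → IsMap N′ → N ≅ N′ → HasKernel N′ K → HasKernel N K
  ≅-HasKernel isMap N≅N′ kernel = record
    { sameElement = λ u v →
        ⇔.trans (≅-SameElement N≅N′ (≈-isEquivalence isMap) u v) (sameElement u v)
    ; sameFlag    = λ u v → ⇔.trans (≅-SameFlag N≅N′ isMap u v) (sameFlag u v)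
    }
    where open HasKernel kernel

  ∥-HasKernel : ∀ {M₁ M₂ H₁ H₂} → HasKernel M₁ H₁ → HasKernel M₂ H₂ →
                HasKernel (M₁ ∥ M₂) (H₁ ∩ H₂)
  ∥-HasKernel {M₁} {M₂} kernel₁ kernel₂ = record
    { sameElement = λ u v →
        ⇔.trans (SameElement-∥ M₁ M₂ u v) (K₁.sameElement u v ×-⇔ K₂.sameElement u v)
    ; sameFlag    = λ u v →
        ⇔.trans (SameFlag-∥ M₁ M₂ u v) (K₁.sameFlag u v ×-⇔ K₂.sameFlag u v)
    }
    where
    module K₁ = HasKernel kernel₁
    module K₂ = HasKernel kernel₂

  ∥-≅-of-kernels : ∀ {M₁ M₂ N H₁ H₂ K} → IsMap N →
                   HasKernel M₁ H₁ → HasKernel M₂ H₂ → HasKernel N K →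
                   (∀ g → (H₁ ∩ H₂) g ⇔ K g) → (M₁ ∥ M₂) ≅ N
  ∥-≅-of-kernels {M₁} {M₂} isMap kernel₁ kernel₂ kernel K⇔ = ∥-≅ {M₁} {M₂} isMap
    (λ u v → ⇔.trans (K₁.sameElement u v ×-⇔ K₂.sameElement u v)
               (⇔.trans (K⇔ _) (⇔.sym (N.sameElement u v))))
    (λ u v → ⇔.trans (K₁.sameFlag u v ×-⇔ K₂.sameFlag u v)
               (⇔.trans (K⇔ _) (⇔.sym (N.sameFlag u v))))
    where
    module K₁ = HasKernel kernel₁
    module K₂ = HasKernel kernel₂
    module N = HasKernel kernel

  regular-isMap : T ∙ T ≈ ε → L ∙ L ≈ ε → R ∙ R ≈ ε → (T ∙ L) ∙ (T ∙ L) ≈ ε →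
                  (∀ g → ∃[ w ] f w ≈ g) →
                  (∃[ n ] Σ (Fin n → Carrier) λ e → ∀ g → ∃[ i ] e i ≈ g) →
                  IsMap M
  regular-isMap rel-T rel-L rel-R rel-TL f-surj finite = record
    { isGroup   = isGroup
    ; Z-equiv   = isEquivalence
    ; ·-cong    = ∙-cong
    ; ·-ε       = identityʳ
    ; ·-∙       = λ z g h → sym (assoc z g h)
    ; rel-T     = rel-T
    ; rel-L     = rel-L
    ; rel-R     = rel-R
    ; rel-TL    = rel-TL
    ; f-surj    = f-surj
    ; trans-act = λ z w → z \\ w , \\-leftDividesˡ z w
    ; faithful  = λ g fixes → trans (sym (identityˡ g)) (fixes ε)
    ; finite    = finite
    }

  kernel-normal : ∀ {G′ : Group 0ℓ 0ℓ} {h} → IsGroupHomomorphism rawGroup (Group.rawGroup G′) h →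
                  IsNormalSubgroup M (λ g → Group._≈_ G′ (h g) (Group.ε G′))
  kernel-normal {G′} {h} homomorphism = record
    { H-resp = λ x≈y hx≈ε → G′.trans (G′.sym (⟦⟧-cong x≈y)) hx≈ε
    ; H-ε    = ε-homo
    ; H-∙    = λ {x} {y} hx≈ε hy≈ε →
        G′.trans (homo x y) (G′.trans (G′.∙-cong hx≈ε hy≈ε) (G′.identityˡ G′.ε))
    ; H-⁻¹   = λ {x} hx≈ε → G′.trans (⁻¹-homo x) (G′.trans (G′.⁻¹-cong hx≈ε) ε⁻¹≈ε′)
    ; H-conj = λ g {x} hx≈ε → begin
        h (g ⁻¹ ∙ x ∙ g)              ≈⟨ homo (g ⁻¹ ∙ x) g ⟩
        h (g ⁻¹ ∙ x) G′.∙ h g         ≈⟨ G′.∙-congʳ (homo (g ⁻¹) x) ⟩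
        h (g ⁻¹) G′.∙ h x G′.∙ h g    ≈⟨ G′.∙-congʳ (G′.trans (G′.∙-congˡ hx≈ε) (G′.identityʳ _)) ⟩
        h (g ⁻¹) G′.∙ h g             ≈⟨ homo (g ⁻¹) g ⟨
        h (g ⁻¹ ∙ g)                  ≈⟨ ⟦⟧-cong (inverseˡ g) ⟩
        h ε                           ≈⟨ ε-homo ⟩
        G′.ε                          ∎
    }
    where
    module G′ = Group G′
    open IsGroupHomomorphism homomorphism
    open GroupProperties G′ using () renaming (ε⁻¹≈ε to ε⁻¹≈ε′)
    open SetoidReasoning G′.setoid

  module Quotient {H : Pred Carrier 0ℓ} (normal : IsNormalSubgroup M H) where
    open IsNormalSubgroup normal public
    open SetoidReasoning setoid

    f-△≈ : ∀ w → MapData.f (M △ H) w ≈ f w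
    f-△≈ w = reflexive (f-△ M H w)

    ≈ε⇒∈ : ∀ {x} → x ≈ ε → H x
    ≈ε⇒∈ x≈ε = H-resp (sym x≈ε) H-ε

    ≈⇒// : ∀ {x y} → x ≈ y → H (x // y)
    ≈⇒// x≈y = ≈ε⇒∈ (x≈y⇒x∙y⁻¹≈ε x≈y)

    conj : ∀ g {h} → H h → H (g ∙ h ∙ g ⁻¹)
    conj g {h} h∈H = H-resp (∙-congʳ (∙-congʳ (⁻¹-involutive g))) (H-conj (g ⁻¹) h∈H)

    //-sym : ∀ {x y} → H (x // y) → H (y // x)
    //-sym {x} {y} p = H-resp (begin
      (x ∙ y ⁻¹) ⁻¹     ≈⟨ ⁻¹-anti-homo-∙ x (y ⁻¹) ⟩
      y ⁻¹ ⁻¹ ∙ x ⁻¹    ≈⟨ ∙-congʳ (⁻¹-involutive y) ⟩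
      y ∙ x ⁻¹          ∎) (H-⁻¹ p)

    //-trans : ∀ {x y z} → H (x // y) → H (y // z) → H (x // z)
    //-trans {x} {y} {z} p q = H-resp (begin
      x ∙ y ⁻¹ ∙ (y ∙ z ⁻¹)    ≈⟨ assoc x (y ⁻¹) (y ∙ z ⁻¹) ⟩
      x ∙ (y \\ (y ∙ z ⁻¹))   ≈⟨ ∙-congˡ (\\-leftDividesʳ y (z ⁻¹)) ⟩
      x ∙ z ⁻¹                ∎) (H-∙ p q)

    //⇒\\ : ∀ {x y} → H (x // y) → H (x \\ y)
    //⇒\\ {x} {y} p = H-resp (begin
      x ⁻¹ ∙ (y // x) ∙ x      ≈⟨ assoc (x ⁻¹) (y // x) x ⟩
      x ⁻¹ ∙ ((y // x) ∙ x)    ≈⟨ ∙-congˡ (//-rightDividesˡ x y) ⟩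
      x ⁻¹ ∙ y                 ∎) (H-conj x (//-sym p))

    \\⇒// : ∀ {x y} → H (x \\ y) → H (x // y)
    \\⇒// {x} {y} p = H-resp (∙-cong (⁻¹-involutive x) refl)
      (//⇒\\ (H-resp (∙-congˡ (sym (⁻¹-involutive y))) p))

    //-∙-cong : ∀ {x y u v} → H (x // y) → H (u // v) → H ((x ∙ u) // (y ∙ v))
    //-∙-cong {x} {y} {u} {v} p q = H-resp (begin
      x ∙ y ⁻¹ ∙ (y ∙ (u ∙ v ⁻¹) ∙ y ⁻¹)   ≈⟨ assoc x (y ⁻¹) _ ⟩
      x ∙ (y ⁻¹ ∙ (y ∙ (u ∙ v ⁻¹) ∙ y ⁻¹)) ≈⟨ ∙-congˡ (assoc (y ⁻¹) _ (y ⁻¹)) ⟨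
      x ∙ ((y \\ (y ∙ (u ∙ v ⁻¹))) ∙ y ⁻¹) ≈⟨ ∙-congˡ (∙-congʳ (\\-leftDividesʳ y _)) ⟩
      x ∙ (u ∙ v ⁻¹ ∙ y ⁻¹)               ≈⟨ ∙-congˡ (assoc u (v ⁻¹) (y ⁻¹)) ⟩
      x ∙ (u ∙ (v ⁻¹ ∙ y ⁻¹))             ≈⟨ assoc x u _ ⟨
      x ∙ u ∙ (v ⁻¹ ∙ y ⁻¹)               ≈⟨ ∙-congˡ (⁻¹-anti-homo-∙ y v) ⟨
      x ∙ u ∙ (y ∙ v) ⁻¹                  ∎) (H-∙ p (conj y q))

    //-⁻¹-cong : ∀ {x y} → H (x // y) → H (x ⁻¹ // y ⁻¹)
    //-⁻¹-cong p = H-resp (∙-congˡ (sym (⁻¹-involutive _))) (//⇒\\ p)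

    quotient-isGroup : IsGroup (λ x y → H (x // y)) _∙_ ε _⁻¹
    quotient-isGroup = record
      { isMonoid = record
        { isSemigroup = record
          { isMagma = record
            { isEquivalence = record { refl = ≈⇒// refl ; sym = //-sym ; trans = //-trans }
            ; ∙-cong = //-∙-cong }
          ; assoc = λ x y z → ≈⇒// (assoc x y z) }
        ; identity = (λ x → ≈⇒// (identityˡ x)) , (λ x → ≈⇒// (identityʳ x)) }
      ; inverse = (λ x → ≈⇒// (inverseˡ x)) , (λ x → ≈⇒// (inverseʳ x))
      ; ⁻¹-cong = //-⁻¹-cong
      }

    coset⇔// : ∀ {z w} → (∃[ h ] (H h × z ∙ h ≈ w)) ⇔ H (z // w)
    coset⇔// {z} {w} = mk⇔
      (λ (h , h∈H , zh≈w) → \\⇒// (H-resp (trans (sym (\\-leftDividesʳ z h)) (∙-congˡ zh≈w)) h∈H))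
      (λ p → z \\ w , //⇒\\ p , \\-leftDividesˡ z w)

    coset-≈⇒ : ∀ {z w} → z ≈ w → ∃[ h ] (H h × z ∙ h ≈ w)
    coset-≈⇒ z≈w = from coset⇔// (≈⇒// z≈w)

    △-isMap : IsMap M → IsMap (M △ H)
    △-isMap isMap = record
      { isGroup   = quotient-isGroup
      ; Z-equiv   = record
        { refl  = coset-≈⇒ refl
        ; sym   = λ p → from coset⇔// (//-sym (to coset⇔// p))
        ; trans = λ p q → from coset⇔// (//-trans (to coset⇔// p) (to coset⇔// q)) }
      ; ·-cong    = λ p q → from coset⇔// (//-∙-cong (to coset⇔// p) q)
      ; ·-ε       = λ z → coset-≈⇒ (identityʳ z)
      ; ·-∙       = λ z g h → coset-≈⇒ (sym (assoc z g h))
      ; rel-T     = ≈⇒// M.rel-T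
      ; rel-L     = ≈⇒// M.rel-L
      ; rel-R     = ≈⇒// M.rel-R
      ; rel-TL    = ≈⇒// M.rel-TL
      ; f-surj    = λ g → let (w , fw≈g) = M.f-surj g in w , ≈⇒// (trans (f-△≈ w) fw≈g)
      ; trans-act = λ z w → z \\ w , coset-≈⇒ (\\-leftDividesˡ z w)
      ; faithful  = λ g fixes → H-resp (∙-congʳ (identityˡ g)) (to coset⇔// (fixes ε))
      ; finite    = let (n , e , cover) = M.finite
                    in n , e , λ z → let (i , eᵢ≈z) = cover z in i , coset-≈⇒ eᵢ≈z
      }
      where module M = IsMap isMap

    H-resp⇔ : ∀ {x y} → x ≈ y → H x ⇔ H y
    H-resp⇔ x≈y = mk⇔ (H-resp x≈y) (H-resp (sym x≈y))

    △-HasKernel : HasKernel (M △ H) H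
    △-HasKernel = record
      { sameElement = λ u v → H-resp⇔ (//-cong₂ (f-△≈ u) (f-△≈ v))
      ; sameFlag    = λ u v → ⇔.trans coset⇔//
          (H-resp⇔ (//-cong₂ (trans (identityˡ _) (f-△≈ u)) (trans (identityˡ _) (f-△≈ v))))
      }

  record NormalSplitting : Set₁ where
    field
      H₁ H₂     : Pred Carrier 0ℓ
      H₁-normal : IsNormalSubgroup M H₁
      H₂-normal : IsNormalSubgroup M H₂
      ∩-trivial : H₁ ∩ H₂ ⊆ (_≈ ε)
      H₁⊈H₂     : ¬ (H₁ ⊆ H₂)
      H₂⊈H₁     : ¬ (H₂ ⊆ H₁)

  ≈ε-resp : (_≈ ε) Respects _≈_
  ≈ε-resp x≈y x≈ε = trans (sym x≈y) x≈ε

  ∩-resp : ∀ {H₁ H₂} → IsNormalSubgroup M H₁ → IsNormalSubgroup M H₂ →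
           (H₁ ∩ H₂) Respects _≈_
  ∩-resp normal₁ normal₂ x≈y (x∈H₁ , x∈H₂) =
    IsNormalSubgroup.H-resp normal₁ x≈y x∈H₁ , IsNormalSubgroup.H-resp normal₂ x≈y x∈H₂

  module _ (isMap : IsMap M) where
    open IsMap isMap using (f-surj)

    kernel-⊆ : ∀ {A B K K′} → IsEquivalence (MapData._≈_ B) → A ≅ B →
               HasKernel A K → HasKernel B K′ → K Respects _≈_ → K′ Respects _≈_ → K′ ⊆ K
    kernel-⊆ ≈-equiv A≅B kernelA kernelB K-resp K′-resp {g} g∈K′ =
      K-resp fw//ε≈g (to (A.sameElement w [])
        (from (≅-SameElement A≅B ≈-equiv w [])
          (from (B.sameElement w []) (K′-resp (sym fw//ε≈g) g∈K′))))
      where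
      module A = HasKernel kernelA
      module B = HasKernel kernelB
      w : FWord
      w = proj₁ (f-surj g)
      fw//ε≈g : f w // ε ≈ g
      fw//ε≈g = trans (∙-congˡ ε⁻¹≈ε) (trans (identityʳ (f w)) (proj₂ (f-surj g)))

    decomposable⇒splitting : ParallelProductDecomposable M → NormalSplitting
    decomposable⇒splitting
      (M₁ , M₂ , isMap₁ , isMap₂ , (H₁ , normal₁ , M₁≅) , (H₂ , normal₂ , M₂≅) , M≅ , ≇M₁ , ≇M₂) =
      record
      { H₁ = H₁ ; H₂ = H₂ ; H₁-normal = normal₁ ; H₂-normal = normal₂
      ; ∩-trivial = kernel-⊆ (∥-isEquivalence isMap₁ isMap₂) M≅ regular-HasKernel
                      (∥-HasKernel kernel₁ kernel₂) ≈ε-resp (∩-resp normal₁ normal₂)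
      ; H₁⊈H₂ = λ H₁⊆H₂ → ≇M₁
          (∥-≅-of-kernels isMap₁ kernel₁ kernel₂ kernel₁ (λ _ → mk⇔ proj₁ (λ h → h , H₁⊆H₂ h)))
      ; H₂⊈H₁ = λ H₂⊆H₁ → ≇M₂
          (∥-≅-of-kernels isMap₂ kernel₁ kernel₂ kernel₂ (λ _ → mk⇔ proj₂ (λ h → H₂⊆H₁ h , h)))
      }
      where
      module Q₁ = Quotient normal₁
      module Q₂ = Quotient normal₂
      kernel₁ : HasKernel M₁ H₁
      kernel₁ = ≅-HasKernel (Q₁.△-isMap isMap) M₁≅ Q₁.△-HasKernel
      kernel₂ : HasKernel M₂ H₂
      kernel₂ = ≅-HasKernel (Q₂.△-isMap isMap) M₂≅ Q₂.△-HasKernel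

    splitting⇒decomposable : NormalSplitting → ParallelProductDecomposable M
    splitting⇒decomposable splitting =
      M △ H₁ , M △ H₂ , Q₁.△-isMap isMap , Q₂.△-isMap isMap ,
      (H₁ , H₁-normal , ≅-refl (Q₁.△-isMap isMap)) , (H₂ , H₂-normal , ≅-refl (Q₂.△-isMap isMap)) ,
      ≅-sym isMap (∥-≅-of-kernels isMap Q₁.△-HasKernel Q₂.△-HasKernel regular-HasKernel
        (λ _ → mk⇔ ∩-trivial (λ g≈ε → Q₁.≈ε⇒∈ g≈ε , Q₂.≈ε⇒∈ g≈ε))) ,
      (λ ∥≅M₁ → H₁⊈H₂ λ g∈H₁ → proj₂ (kernel-⊆ (≈-isEquivalence (Q₁.△-isMap isMap)) ∥≅M₁
         kernel-∥ Q₁.△-HasKernel H-resp-∩ Q₁.H-resp g∈H₁)) ,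
      (λ ∥≅M₂ → H₂⊈H₁ λ g∈H₂ → proj₁ (kernel-⊆ (≈-isEquivalence (Q₂.△-isMap isMap)) ∥≅M₂
         kernel-∥ Q₂.△-HasKernel H-resp-∩ Q₂.H-resp g∈H₂))
      where
      open NormalSplitting splitting
      module Q₁ = Quotient H₁-normal
      module Q₂ = Quotient H₂-normal
      kernel-∥ : HasKernel ((M △ H₁) ∥ (M △ H₂)) (H₁ ∩ H₂)
      kernel-∥ = ∥-HasKernel Q₁.△-HasKernel Q₂.△-HasKernel
      H-resp-∩ : (H₁ ∩ H₂) Respects _≈_
      H-resp-∩ = ∩-resp H₁-normal H₂-normal

    decomposable⇔splitting : ParallelProductDecomposable M ⇔ NormalSplitting
    decomposable⇔splitting = mk⇔ decomposable⇒splitting splitting⇒decomposable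

module Arithmetic where

  open import Data.Empty using (⊥-elim)
  open import Data.Integer as ℤ using (+_)
  open import Data.Integer.Divisibility.Signed as ℤ∣ using (divides)
  open import Data.Integer.Properties using (pos-+; pos-*)
  open import Data.Integer.Tactic.RingSolver using (solve-∀)
  open import Data.List.Relation.Unary.All using (All; []; _∷_)
  open import Data.Nat
  open import Data.Nat.Coprimality as Coprime using (Coprime; coprime-divisor)
  open import Data.Nat.Divisibility
  open import Data.Nat.GCD using (gcd; gcd[m,n]∣m; gcd[m,n]∣n; gcd-GCD; module Bézout)
  open import Data.Nat.ListAction using (product)
  open import Data.Nat.Primality
  open import Data.Nat.Primality.Factorisation using (factorise)
  open import Data.Nat.Properties
  open import Data.Product using (∃₂)
  open import Data.Sum using (_⊎_; inj₁; inj₂; [_,_]′)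
  open import Relation.Binary.PropositionalEquality
  open import Relation.Nullary using (yes; no)

  prime>1 : ∀ {p} → Prime p → 1 < p
  prime>1 {p} p-prime = nonTrivial⇒n>1 p {{prime⇒nonTrivial p-prime}}

  prime∤⇒coprime : ∀ {p n} → Prime p → ¬ p ∣ n → Coprime p n
  prime∤⇒coprime p-prime p∤n (d∣p , d∣n) with prime⇒irreducible p-prime d∣p
  ... | inj₁ d≡1 = d≡1
  ... | inj₂ refl = ⊥-elim (p∤n d∣n)

  coprime-*ʳ : ∀ {a b c} → Coprime a b → Coprime a c → Coprime a (b * c)
  coprime-*ʳ a⊥b a⊥c (i∣a , i∣bc) =
    a⊥c (i∣a , coprime-divisor (λ (j∣i , j∣b) → a⊥b (∣-trans j∣i i∣a , j∣b)) i∣bc)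

  prime∣^⇒∣ : ∀ {p q} → Prime p → ∀ e → p ∣ q ^ e → p ∣ q
  prime∣^⇒∣ p-prime zero    p∣1 = ⊥-elim (<⇒≢ (prime>1 p-prime) (sym (∣1⇒≡1 p∣1)))
  prime∣^⇒∣ {q = q} p-prime (suc e) p∣qqᵉ =
    [ (λ p∣q → p∣q) , prime∣^⇒∣ p-prime e ]′ (euclidsLemma q (q ^ e) p-prime p∣qqᵉ)

  coprime⇒*∣ : ∀ {m n x} → Coprime m n → m ∣ x → n ∣ x → m * n ∣ x
  coprime⇒*∣ {m} {n} m⊥n (divides a refl) n∣am = subst (m * n ∣_) (*-comm m a)
    (*-monoʳ-∣ m (coprime-divisor (Coprime.sym m⊥n) (subst (n ∣_) (*-comm a m) n∣am)))

  CoprimeSplit : ℕ → Set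
  CoprimeSplit k = ∃₂ λ m n → 1 < m × 1 < n × Coprime m n × m * n ≡ k

  private
    1<[1+e]^ : ∀ {q} → 1 < q → ∀ e → 1 < q ^ suc e
    1<[1+e]^ {q} 1<q e =
      <-≤-trans 1<q (m≤m*n q (q ^ e) {{m^n≢0 q e {{>-nonZero (<-trans z<s 1<q)}}}})

    1<p*n : ∀ {p n} → Prime p → 1 < n → 1 < p * n
    1<p*n {p} {n} p-prime 1<n = <-≤-trans 1<n (m≤n*m n p {{prime⇒nonZero p-prime}})

  *-PrimePower : ∀ {p n} → Prime p → IsPrimePower n → IsPrimePower (p * n) ⊎ CoprimeSplit (p * n)
  *-PrimePower {p} p-prime (q , suc e , q-prime , _ , refl) with p ≟ q
  ... | yes refl = inj₁ (p , suc (suc e) , p-prime , z<s , refl)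
  ... | no p≢q   =
    inj₂ (p , q ^ suc e , prime>1 p-prime , 1<[1+e]^ (prime>1 q-prime) e , p⊥qᵉ , refl)
    where
    p⊥qᵉ : Coprime p (q ^ suc e)
    p⊥qᵉ = prime∤⇒coprime p-prime λ p∣qᵉ →
      [ (λ p≡1 → <⇒≢ (prime>1 p-prime) (sym p≡1)) , p≢q ]′
        (prime⇒irreducible q-prime (prime∣^⇒∣ p-prime (suc e) p∣qᵉ))

  *-CoprimeSplit : ∀ {p n} → Prime p → CoprimeSplit n → CoprimeSplit (p * n)
  *-CoprimeSplit {p} p-prime (a , b , 1<a , 1<b , a⊥b , refl) with p ∣? b
  ... | yes p∣b = a , p * b , 1<a , 1<p*n p-prime 1<b , coprime-*ʳ a⊥p a⊥b , x*[y*z]≡y*[x*z] a p b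
    where
    a⊥p : Coprime a p
    a⊥p = Coprime.sym (prime∤⇒coprime p-prime λ p∣a → <⇒≢ (prime>1 p-prime) (sym (a⊥b (p∣a , p∣b))))
    x*[y*z]≡y*[x*z] : ∀ x y z → x * (y * z) ≡ y * (x * z)
    x*[y*z]≡y*[x*z] x y z =
      trans (sym (*-assoc x y z)) (trans (cong (_* z) (*-comm x y)) (*-assoc y x z))
  ... | no p∤b = p * a , b , 1<p*n p-prime 1<a , 1<b ,
                 Coprime.sym (coprime-*ʳ (Coprime.sym (prime∤⇒coprime p-prime p∤b))
                                         (Coprime.sym a⊥b)) ,
                 *-assoc p a b

  primeProduct-classification : ∀ {ps} → All Prime ps →
    product ps ≡ 1 ⊎ IsPrimePower (product ps) ⊎ CoprimeSplit (product ps)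
  primeProduct-classification [] = inj₁ refl
  primeProduct-classification {p ∷ ps} (p-prime ∷ ps-prime)
    with primeProduct-classification ps-prime
  ... | inj₁ ∏≡1        = inj₂ (inj₁ (p , 1 , p-prime , z<s , cong (p *_) ∏≡1))
  ... | inj₂ (inj₁ ∏pp) = inj₂ (*-PrimePower p-prime ∏pp)
  ... | inj₂ (inj₂ ∏cs) = inj₂ (inj₂ (*-CoprimeSplit p-prime ∏cs))

  ¬IsPrimePower⇒CoprimeSplit : ∀ {k} → 1 < k → ¬ IsPrimePower k → CoprimeSplit k
  ¬IsPrimePower⇒CoprimeSplit {k} 1<k ¬pp
    with factorise k {{>-nonZero (<-trans z<s 1<k)}}
  ... | record { factors = ps ; isFactorisation = refl ; factorsPrime = ps-prime }
    with primeProduct-classification ps-prime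
  ...   | inj₁ ∏≡1        = ⊥-elim (<⇒≢ 1<k (sym ∏≡1))
  ...   | inj₂ (inj₁ ∏pp) = ⊥-elim (¬pp ∏pp)
  ...   | inj₂ (inj₂ ∏cs) = ∏cs

  ∣p^[1+e]⇒∣p^e : ∀ {p} → Prime p → ∀ e {d} → d ∣ p ^ suc e → d ≢ p ^ suc e → d ∣ p ^ e
  ∣p^[1+e]⇒∣p^e {p} p-prime zero {d} d∣p d≢p
    with prime⇒irreducible p-prime (subst (d ∣_) (*-identityʳ p) d∣p)
  ... | inj₁ refl = ∣-refl
  ... | inj₂ refl = ⊥-elim (d≢p (sym (*-identityʳ p)))
  ∣p^[1+e]⇒∣p^e {p} p-prime (suc e) {d} d∣ d≢ with p ∣? d
  ... | no p∤d = coprime-divisor (Coprime.sym (prime∤⇒coprime p-prime p∤d)) d∣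
  ... | yes (divides d′ refl) =
    subst (_∣ p ^ suc e) (*-comm p d′) (*-monoʳ-∣ p (∣p^[1+e]⇒∣p^e p-prime e d′∣ d′≢))
    where
    instance _ = prime⇒nonZero p-prime
    d′∣ : d′ ∣ p ^ suc e
    d′∣ = *-cancelˡ-∣ p (subst (_∣ p ^ suc (suc e)) (*-comm d′ p) d∣)
    d′≢ : d′ ≢ p ^ suc e
    d′≢ d′≡ = d≢ (trans (cong (_* p) d′≡) (*-comm _ p))

  p^[1+e]∤p^e : ∀ {p} → Prime p → ∀ e → ¬ p ^ suc e ∣ p ^ e
  p^[1+e]∤p^e {p} p-prime e p^[1+e]∣p^e = <⇒≱ (p^e<p^[1+e]) (∣⇒≤ {{m^n≢0 p e}} p^[1+e]∣p^e)
    where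
    instance _ = prime⇒nonZero p-prime
    p^e<p^[1+e] : p ^ e < p ^ suc e
    p^e<p^[1+e] =
      subst (p ^ e <_) (*-comm (p ^ e) p) (m<m*n (p ^ e) p {{m^n≢0 p e}} (prime>1 p-prime))

  gcd∣⇒congruence-solvable : ∀ a k q → gcd a k ∣ q → ∃[ c ] (+ k ℤ∣.∣ c ℤ.* + a ℤ.- + q)
  gcd∣⇒congruence-solvable a k q (divides u refl) = solve (Bézout.identity (gcd-GCD a k))
    where
    open ≡-Reasoning
    d : ℕ
    d = gcd a k

    pos-identity : ∀ x y z w → d + x * y ≡ z * w → + d ℤ.+ + x ℤ.* + y ≡ + z ℤ.* + w
    pos-identity x y z w eq = begin
      + d ℤ.+ + x ℤ.* + y  ≡⟨ cong (λ i → + d ℤ.+ i) (pos-* x y) ⟨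
      + d ℤ.+ + (x * y)    ≡⟨ pos-+ d (x * y) ⟨
      + (d + x * y)        ≡⟨ cong +_ eq ⟩
      + (z * w)            ≡⟨ pos-* z w ⟩
      + z ℤ.* + w          ∎

    solve : Bézout.Identity d a k → ∃[ c ] (+ k ℤ∣.∣ c ℤ.* + a ℤ.- + (u * d))
    solve (Bézout.+- x y d+yk≡xa) = + u ℤ.* + x , divides (+ u ℤ.* + y) (begin
      (+ u ℤ.* + x) ℤ.* + a ℤ.- + (u * d)           ≡⟨ cong (λ i → (+ u ℤ.* + x) ℤ.* + a ℤ.- i)
                                                          (pos-* u d) ⟩
      (+ u ℤ.* + x) ℤ.* + a ℤ.- + u ℤ.* + d          ≡⟨ reassoc (+ u) (+ x) (+ a) (+ d) ⟩
      + u ℤ.* (+ x ℤ.* + a) ℤ.- + u ℤ.* + d          ≡⟨ cong (λ i → + u ℤ.* i ℤ.- + u ℤ.* + d)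
                                                          (pos-identity y k x a d+yk≡xa) ⟨
      + u ℤ.* (+ d ℤ.+ + y ℤ.* + k) ℤ.- + u ℤ.* + d  ≡⟨ cancel (+ u) (+ d) (+ y) (+ k) ⟩
      (+ u ℤ.* + y) ℤ.* + k                          ∎)
      where
      reassoc : ∀ u x a d → (u ℤ.* x) ℤ.* a ℤ.- u ℤ.* d ≡ u ℤ.* (x ℤ.* a) ℤ.- u ℤ.* d
      reassoc = solve-∀
      cancel : ∀ u d y k → u ℤ.* (d ℤ.+ y ℤ.* k) ℤ.- u ℤ.* d ≡ (u ℤ.* y) ℤ.* k
      cancel = solve-∀
    solve (Bézout.-+ x y d+xa≡yk) = ℤ.- (+ u ℤ.* + x) , divides (ℤ.- (+ u ℤ.* + y)) (begin
      ℤ.- (+ u ℤ.* + x) ℤ.* + a ℤ.- + (u * d)        ≡⟨ cong (λ i → ℤ.- (+ u ℤ.* + x) ℤ.* + a ℤ.- i)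
                                                           (pos-* u d) ⟩
      ℤ.- (+ u ℤ.* + x) ℤ.* + a ℤ.- + u ℤ.* + d       ≡⟨ regroup (+ u) (+ x) (+ a) (+ d) ⟩
      ℤ.- (+ u ℤ.* (+ d ℤ.+ + x ℤ.* + a))             ≡⟨ cong (λ i → ℤ.- (+ u ℤ.* i))
                                                           (pos-identity x a y k d+xa≡yk) ⟩
      ℤ.- (+ u ℤ.* (+ y ℤ.* + k))                     ≡⟨ reassoc (+ u) (+ y) (+ k) ⟩
      ℤ.- (+ u ℤ.* + y) ℤ.* + k                       ∎)
      where
      regroup : ∀ u x a d → ℤ.- (u ℤ.* x) ℤ.* a ℤ.- u ℤ.* d ≡ ℤ.- (u ℤ.* (d ℤ.+ x ℤ.* a))
      regroup = solve-∀
      reassoc : ∀ u y k → ℤ.- (u ℤ.* (y ℤ.* k)) ≡ ℤ.- (u ℤ.* y) ℤ.* k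
      reassoc = solve-∀

  prime-power-congruence : ∀ {p k} → Prime p → ∀ e → k ≡ p ^ suc e →
                           ∀ a → ¬ k ∣ a → ∃[ c ] (+ k ℤ∣.∣ c ℤ.* + a ℤ.- + (p ^ e))
  prime-power-congruence p-prime e refl a k∤a =
    gcd∣⇒congruence-solvable a _ _ (∣p^[1+e]⇒∣p^e p-prime e (gcd[m,n]∣n a _) gcd≢k)
    where
    gcd≢k : gcd a _ ≢ _
    gcd≢k gcd≡k = k∤a (subst (_∣ a) gcd≡k (gcd[m,n]∣m a _))

module Dihedral where

  import Algebra.Morphism.GroupMonomorphism as GroupMonomorphism
  open import Data.Bool using (Bool; true; false; not)
  open import Data.Bool.Properties using (not-involutive) renaming (_≟_ to _≟ᴮ_)
  open import Data.Empty using (⊥-elim)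
  open import Data.Fin using (toℕ; fromℕ<; splitAt; _↑ˡ_; _↑ʳ_)
  open import Data.Fin.Properties using (splitAt-↑ˡ; splitAt-↑ʳ; toℕ-fromℕ<)
  open import Data.Integer as ℤ using (ℤ; +_; -[1+_]; _+_; _-_; -_; _*_; 0ℤ; 1ℤ; -1ℤ)
  open import Data.Integer.DivMod using (_%ℕ_; _/ℕ_; n%ℕd<d; a≡a%ℕn+[a/ℕn]*n)
  open import Data.Integer.Divisibility.Signed
    using (_∣_; divides; _∣?_; ∣-refl; ∣-trans; ∣m∣n⇒∣m+n; ∣m∣n⇒∣m-n; ∣m⇒∣-m; ∣n⇒∣m*n; ∣ᵤ⇒∣; ∣⇒∣ᵤ)
  open import Data.Integer.Properties
    using ( +-assoc; +-comm; +-identityˡ; +-identityʳ; +-inverseˡ; +-inverseʳ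
          ; *-identityˡ; *-zeroˡ; *-zeroʳ; *-distribʳ-+; neg-distribˡ-*; -1*i≡-i )
  open import Data.Integer.Tactic.RingSolver using (solve-∀)
  open import Data.List using (map)
  import Data.List.Properties as List
  open import Data.List.Membership.Propositional using (_∈_)
  open import Data.List.Relation.Unary.All as All using (All; _∷_; [])
  open import Data.List.Relation.Unary.Any using (here; there)
  open import Data.Nat as ℕ using (zero; suc; NonZero)
  open import Data.Nat.Coprimality as Coprime using (Coprime)
  import Data.Nat.Divisibility as ℕ∣
  open import Data.Nat.Primality using (Prime)
  import Data.Nat.Properties as ℕₚ
  open import Data.Sum using (_⊎_; inj₁; inj₂)
  open import Function using (_∘_)
  open import Relation.Binary.Bundles using (Setoid)
  open import Relation.Binary.PropositionalEquality as ≡ using (refl; cong; cong₂)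
  open import Relation.Nullary using (Dec; yes; no; map′)

  open Arithmetic

  -- (s , i) stands for ρⁱσˢ in the infinite dihedral group ⟨ ρ , σ ∣ σ² , σρσρ ⟩.
  D∞ : Set
  D∞ = Bool × ℤ

  rot ref : ℤ → D∞
  rot i = false , i
  ref i = true , i

  εᴰ : D∞
  εᴰ = rot 0ℤ

  infixl 7 _∙ᴰ_
  _∙ᴰ_ : D∞ → D∞ → D∞
  (false , i) ∙ᴰ (s , j) = s , i + j
  (true  , i) ∙ᴰ (s , j) = not s , i - j

  infix 8 _⁻¹ᴰ
  _⁻¹ᴰ : D∞ → D∞
  (false , i) ⁻¹ᴰ = rot (- i)
  (true  , i) ⁻¹ᴰ = ref i

  private
    [i+j]-k≡i+[j-k] : ∀ i j k → (i + j) - k ≡ i + (j - k)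
    [i+j]-k≡i+[j-k] = solve-∀
    [i-j]-k≡i-[j+k] : ∀ i j k → (i - j) - k ≡ i - (j + k)
    [i-j]-k≡i-[j+k] = solve-∀
    [i-j]+k≡i-[j-k] : ∀ i j k → (i - j) + k ≡ i - (j - k)
    [i-j]+k≡i-[j-k] = solve-∀

  ∙ᴰ-assoc : ∀ x y z → (x ∙ᴰ y) ∙ᴰ z ≡ x ∙ᴰ (y ∙ᴰ z)
  ∙ᴰ-assoc (false , i) (false , j) (s , k) = cong (s ,_) (+-assoc i j k)
  ∙ᴰ-assoc (false , i) (true  , j) (s , k) = cong (not s ,_) ([i+j]-k≡i+[j-k] i j k)
  ∙ᴰ-assoc (true  , i) (false , j) (s , k) = cong (not s ,_) ([i-j]-k≡i-[j+k] i j k)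
  ∙ᴰ-assoc (true  , i) (true  , j) (s , k) = cong₂ _,_ (≡.sym (not-involutive s)) ([i-j]+k≡i-[j-k] i j k)

  ∙ᴰ-identityˡ : ∀ x → εᴰ ∙ᴰ x ≡ x
  ∙ᴰ-identityˡ (s , i) = cong (s ,_) (+-identityˡ i)

  ∙ᴰ-identityʳ : ∀ x → x ∙ᴰ εᴰ ≡ x
  ∙ᴰ-identityʳ (false , i) = cong (false ,_) (+-identityʳ i)
  ∙ᴰ-identityʳ (true  , i) = cong (true ,_) (+-identityʳ i)

  ∙ᴰ-inverseˡ : ∀ x → x ⁻¹ᴰ ∙ᴰ x ≡ εᴰ
  ∙ᴰ-inverseˡ (false , i) = cong (false ,_) (+-inverseˡ i)
  ∙ᴰ-inverseˡ (true  , i) = cong (false ,_) (+-inverseʳ i)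

  ∙ᴰ-inverseʳ : ∀ x → x ∙ᴰ x ⁻¹ᴰ ≡ εᴰ
  ∙ᴰ-inverseʳ (false , i) = cong (false ,_) (+-inverseʳ i)
  ∙ᴰ-inverseʳ (true  , i) = cong (false ,_) (+-inverseʳ i)

  D∞-isGroup : IsGroup _≡_ _∙ᴰ_ εᴰ _⁻¹ᴰ
  D∞-isGroup = record
    { isMonoid = record
      { isSemigroup = record
        { isMagma = record { isEquivalence = ≡.isEquivalence ; ∙-cong = cong₂ _∙ᴰ_ }
        ; assoc = ∙ᴰ-assoc }
      ; identity = ∙ᴰ-identityˡ , ∙ᴰ-identityʳ }
    ; inverse = ∙ᴰ-inverseˡ , ∙ᴰ-inverseʳ
    ; ⁻¹-cong = cong _⁻¹ᴰ
    }

  -- x ~[ k ] y says that x and y have the same image in Dₖ = D∞ / ⟨ ρᵏ ⟩.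
  infix 4 _~[_]_
  data _~[_]_ : D∞ → ℕ → D∞ → Set where
    same : ∀ {s i j k} → + k ∣ i - j → (s , i) ~[ k ] (s , j)

  ~-refl : ∀ {k x} → x ~[ k ] x
  ~-refl {k} {s , i} = same (divides 0ℤ (≡.trans (+-inverseʳ i) (≡.sym (*-zeroˡ (+ k)))))

  ~-reflexive : ∀ {k x y} → x ≡ y → x ~[ k ] y
  ~-reflexive refl = ~-refl

  ~-sym : ∀ {k x y} → x ~[ k ] y → y ~[ k ] x
  ~-sym {x = _ , i} {_ , j} (same k∣i-j) = same (≡.subst (_ ∣_) (neg-minus i j) (∣m⇒∣-m k∣i-j))
    where
    neg-minus : ∀ i j → - (i - j) ≡ j - i
    neg-minus = solve-∀

  ~-trans : ∀ {k x y z} → x ~[ k ] y → y ~[ k ] z → x ~[ k ] z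
  ~-trans {x = _ , i} {_ , j} {_ , n} (same p) (same q) =
    same (≡.subst (_ ∣_) (telescope i j n) (∣m∣n⇒∣m+n p q))
    where
    telescope : ∀ i j n → (i - j) + (j - n) ≡ i - n
    telescope = solve-∀

  ~-∙ᴰ-cong : ∀ {k x y u v} → x ~[ k ] y → u ~[ k ] v → x ∙ᴰ u ~[ k ] y ∙ᴰ v
  ~-∙ᴰ-cong {x = false , i} {_ , j} {_ , i′} {_ , j′} (same p) (same q) =
    same (≡.subst (_ ∣_) (lemma i j i′ j′) (∣m∣n⇒∣m+n p q))
    where
    lemma : ∀ i j i′ j′ → (i - j) + (i′ - j′) ≡ (i + i′) - (j + j′)
    lemma = solve-∀
  ~-∙ᴰ-cong {x = true , i} {_ , j} {_ , i′} {_ , j′} (same p) (same q) =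
    same (≡.subst (_ ∣_) (lemma i j i′ j′) (∣m∣n⇒∣m-n p q))
    where
    lemma : ∀ i j i′ j′ → (i - j) - (i′ - j′) ≡ (i - i′) - (j - j′)
    lemma = solve-∀

  ~-⁻¹ᴰ-cong : ∀ {k x y} → x ~[ k ] y → x ⁻¹ᴰ ~[ k ] y ⁻¹ᴰ
  ~-⁻¹ᴰ-cong {x = false , i} {_ , j} (same p) = same (≡.subst (_ ∣_) (lemma i j) (∣m⇒∣-m p))
    where
    lemma : ∀ i j → - (i - j) ≡ (- i) - (- j)
    lemma = solve-∀
  ~-⁻¹ᴰ-cong {x = true , _} (same p) = same p

  Dₖ-isGroup : ∀ k → IsGroup (_~[ k ]_) _∙ᴰ_ εᴰ _⁻¹ᴰ
  Dₖ-isGroup k = record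
    { isMonoid = record
      { isSemigroup = record
        { isMagma = record
          { isEquivalence = record { refl = ~-refl ; sym = ~-sym ; trans = ~-trans }
          ; ∙-cong = ~-∙ᴰ-cong }
        ; assoc = λ x y z → ~-reflexive (∙ᴰ-assoc x y z) }
      ; identity = (λ x → ~-reflexive (∙ᴰ-identityˡ x)) , (λ x → ~-reflexive (∙ᴰ-identityʳ x)) }
    ; inverse = (λ x → ~-reflexive (∙ᴰ-inverseˡ x)) , (λ x → ~-reflexive (∙ᴰ-inverseʳ x))
    ; ⁻¹-cong = ~-⁻¹ᴰ-cong
    }

  _~?[_]_ : ∀ x k y → Dec (x ~[ k ] y)
  (s , i) ~?[ k ] (s′ , j) with s ≟ᴮ s′ | + k ∣? (i - j)
  ... | yes refl | yes k∣i-j = yes (same k∣i-j)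
  ... | yes refl | no  k∤i-j = no λ { (same k∣i-j) → k∤i-j k∣i-j }
  ... | no  s≢s′ | _         = no λ { (same _) → s≢s′ refl }

  ~-weaken : ∀ {m k x y} → + m ∣ + k → x ~[ k ] y → x ~[ m ] y
  ~-weaken m∣k (same k∣i-j) = same (∣-trans m∣k k∣i-j)

  rot~ε⇔∣ : ∀ {k i} → rot i ~[ k ] εᴰ ⇔ + k ∣ i
  rot~ε⇔∣ {k} {i} = mk⇔
    (λ { (same k∣i-0) → ≡.subst (+ k ∣_) (+-identityʳ i) k∣i-0 })
    (λ k∣i → same (≡.subst (+ k ∣_) (≡.sym (+-identityʳ i)) k∣i))

  ~-lcm : ∀ {m n k x y} → (∀ {z} → + m ∣ z → + n ∣ z → + k ∣ z) →
          x ~[ m ] y → x ~[ n ] y → x ~[ k ] y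
  ~-lcm lcm (same m∣i-j) (same n∣i-j) = same (lcm m∣i-j n∣i-j)

  Dₖ-finite : ∀ k .{{_ : NonZero k}} → ∃[ n ] Σ (Fin n → D∞) λ e → ∀ d → ∃[ i ] e i ~[ k ] d
  Dₖ-finite k = k ℕ.+ k , element ∘ splitAt k , λ d → index d , cover d
    where
    element : Fin k ⊎ Fin k → D∞
    element (inj₁ i) = rot (+ toℕ i)
    element (inj₂ i) = ref (+ toℕ i)

    residue : ℤ → Fin k
    residue j = fromℕ< (n%ℕd<d j k)

    residue~ : ∀ s j → (s , + toℕ (residue j)) ~[ k ] (s , j)
    residue~ s j = same (divides (- (j /ℕ k)) (begin
      + toℕ (residue j) - j                     ≡⟨ cong (λ n → + n - j) (toℕ-fromℕ< (n%ℕd<d j k)) ⟩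
      + (j %ℕ k) - j                            ≡⟨ cong (λ i → + (j %ℕ k) - i) (a≡a%ℕn+[a/ℕn]*n j k) ⟩
      + (j %ℕ k) - (+ (j %ℕ k) + j /ℕ k * + k)  ≡⟨ cancel (+ (j %ℕ k)) (j /ℕ k) (+ k) ⟩
      - (j /ℕ k) * + k                          ∎))
      where
      open ≡.≡-Reasoning
      cancel : ∀ r q k → r - (r + q * k) ≡ - q * k
      cancel = solve-∀

    index : D∞ → Fin (k ℕ.+ k)
    index (false , j) = residue j ↑ˡ k
    index (true  , j) = k ↑ʳ residue j

    cover : ∀ d → element (splitAt k (index d)) ~[ k ] d
    cover (false , j) rewrite splitAt-↑ˡ k (residue j) k = residue~ false j
    cover (true  , j) rewrite splitAt-↑ʳ k k (residue j) = residue~ true j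

  Dₖ : ℕ → Group 0ℓ 0ℓ
  Dₖ k = record { isGroup = Dₖ-isGroup k }

  D∞-group : Group 0ℓ 0ℓ
  D∞-group = record { isGroup = D∞-isGroup }

  data GenImage : Set where
    one a b : GenImage

  -- a and b are reflections with a ∙ᴰ b = ρ.
  image : GenImage → D∞
  image one = εᴰ
  image a   = ref 0ℤ
  image b   = ref -1ℤ

  image-involutive : ∀ x → image x ∙ᴰ image x ≡ εᴰ
  image-involutive one = refl
  image-involutive a   = refl
  image-involutive b   = refl

  image-⁻¹ : ∀ x → image x ⁻¹ᴰ ≡ image x
  image-⁻¹ one = refl
  image-⁻¹ a   = refl
  image-⁻¹ b   = refl

  module _ (κ : Gen → GenImage) where

    -- The sign of a letter is irrelevant since every generator goes to an involution.
    eval : PWord → D∞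
    eval []            = εᴰ
    eval ((x , _) ∷ w) = image (κ x) ∙ᴰ eval w

    eval-++ : ∀ u v → eval (u ++ v) ≡ eval u ∙ᴰ eval v
    eval-++ []      v = ≡.sym (∙ᴰ-identityˡ (eval v))
    eval-++ (y ∷ u) v = ≡.trans (cong (image (κ (proj₁ y)) ∙ᴰ_) (eval-++ u v))
                                (≡.sym (∙ᴰ-assoc _ (eval u) (eval v)))

    eval-pinv : ∀ w → eval (pinv w) ≡ eval w ⁻¹ᴰ
    eval-pinv []            = refl
    eval-pinv ((x , s) ∷ w) = begin
      eval (pinv ((x , s) ∷ w))
        ≡⟨ cong eval (List.unfold-reverse (x , not s) (map inv w)) ⟩
      eval (pinv w ++ [ (x , not s) ])   ≡⟨ eval-++ (pinv w) _ ⟩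
      eval (pinv w) ∙ᴰ (image (κ x) ∙ᴰ εᴰ) ≡⟨ cong₂ _∙ᴰ_ (eval-pinv w) (∙ᴰ-identityʳ _) ⟩
      eval w ⁻¹ᴰ ∙ᴰ image (κ x)           ≡⟨ cong (eval w ⁻¹ᴰ ∙ᴰ_) (image-⁻¹ (κ x)) ⟨
      eval w ⁻¹ᴰ ∙ᴰ image (κ x) ⁻¹ᴰ       ≡⟨ ⁻¹-anti-homo-∙ (image (κ x)) (eval w) ⟨
      (image (κ x) ∙ᴰ eval w) ⁻¹ᴰ         ∎
      where
      open ≡.≡-Reasoning
      open GroupProperties D∞-group using (⁻¹-anti-homo-∙)

    eval-^w : ∀ {w i} → eval w ≡ rot i → ∀ n → eval (w ^w n) ≡ rot (i * + n)
    eval-^w {w} {i} eval-w zero    = cong rot (≡.sym (*-zeroʳ i))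
    eval-^w {w} {i} eval-w (suc n) = begin
      eval (w ++ w ^w n)         ≡⟨ eval-++ w (w ^w n) ⟩
      eval w ∙ᴰ eval (w ^w n)    ≡⟨ cong₂ _∙ᴰ_ eval-w (eval-^w eval-w n) ⟩
      rot (i + i * + n)          ≡⟨ cong rot (distrib i (+ n)) ⟩
      rot (i * + suc n)          ∎
      where
      open ≡.≡-Reasoning
      distrib : ∀ i n → i + i * n ≡ i * (1ℤ + n)
      distrib = solve-∀

    eval-^w~ε : ∀ {w} → eval w ≡ rot 1ℤ → ∀ k → eval (w ^w k) ~[ k ] εᴰ
    eval-^w~ε eval-w k =
      ~-trans (~-reflexive (eval-^w eval-w k)) (from rot~ε⇔∣ (∣n⇒∣m*n 1ℤ (∣-refl {+ k})))

  module Presentation (rels : List PWord) where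

    infix 4 _≈ᵖ_
    _≈ᵖ_ : PWord → PWord → Set
    _≈ᵖ_ = PresEq rels

    ≡⇒≈ᵖ : ∀ {u v} → u ≡ v → u ≈ᵖ v
    ≡⇒≈ᵖ refl = pe-refl

    ++-congˡ : ∀ w {u v} → u ≈ᵖ v → w ++ u ≈ᵖ w ++ v
    ++-congˡ w pe-refl          = pe-refl
    ++-congˡ w (pe-sym p)       = pe-sym (++-congˡ w p)
    ++-congˡ w (pe-trans p q)   = pe-trans (++-congˡ w p) (++-congˡ w q)
    ++-congˡ w (pe-free u v x)  =
      ≡.subst₂ _≈ᵖ_ (List.++-assoc w u _) (List.++-assoc w u v) (pe-free (w ++ u) v x)
    ++-congˡ w (pe-rel u v ρ∈) =
      ≡.subst₂ _≈ᵖ_ (List.++-assoc w u _) (List.++-assoc w u v) (pe-rel (w ++ u) v ρ∈)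

    ++-congʳ : ∀ w {u v} → u ≈ᵖ v → u ++ w ≈ᵖ v ++ w
    ++-congʳ w pe-refl          = pe-refl
    ++-congʳ w (pe-sym p)       = pe-sym (++-congʳ w p)
    ++-congʳ w (pe-trans p q)   = pe-trans (++-congʳ w p) (++-congʳ w q)
    ++-congʳ w (pe-free u v x)  = ≡.subst₂ _≈ᵖ_
      (≡.sym (List.++-assoc u _ w)) (≡.sym (List.++-assoc u v w)) (pe-free u (v ++ w) x)
    ++-congʳ w (pe-rel u v {ρ} ρ∈) = ≡.subst₂ _≈ᵖ_
      (≡.sym (≡.trans (List.++-assoc u (ρ ++ v) w) (cong (u ++_) (List.++-assoc ρ v w))))
      (≡.sym (List.++-assoc u v w)) (pe-rel u (v ++ w) ρ∈)

    ++-cong : ∀ {u u′ v v′} → u ≈ᵖ u′ → v ≈ᵖ v′ → u ++ v ≈ᵖ u′ ++ v′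
    ++-cong {u′ = u′} {v} p q = pe-trans (++-congʳ v p) (++-congˡ u′ q)

    ≈ᵖ-setoid : Setoid 0ℓ 0ℓ
    ≈ᵖ-setoid = record
      { Carrier = PWord ; _≈_ = _≈ᵖ_
      ; isEquivalence = record { refl = pe-refl ; sym = pe-sym ; trans = pe-trans } }

    presentedRawGroup : RawGroup 0ℓ 0ℓ
    presentedRawGroup = record { Carrier = PWord ; _≈_ = _≈ᵖ_ ; _∙_ = _++_ ; ε = [] ; _⁻¹ = pinv }

    relator≈ε : ∀ {ρ} → ρ ∈ rels → ρ ≈ᵖ []
    relator≈ε {ρ} ρ∈ = ≡.subst (_≈ᵖ []) (List.++-identityʳ ρ) (pe-rel [] [] ρ∈)

    sound : ∀ {k} κ → All (λ ρ → eval κ ρ ~[ k ] εᴰ) rels →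
            ∀ {u v} → u ≈ᵖ v → eval κ u ~[ k ] eval κ v
    sound κ relators pe-refl        = ~-refl
    sound κ relators (pe-sym p)     = ~-sym (sound κ relators p)
    sound κ relators (pe-trans p q) = ~-trans (sound κ relators p) (sound κ relators q)
    sound κ relators (pe-free u v (x , s)) = ~-reflexive (begin
      eval κ (u ++ (x , s) ∷ (x , not s) ∷ v)  ≡⟨ eval-++ κ u _ ⟩
      eval κ u ∙ᴰ (gˣ ∙ᴰ (gˣ ∙ᴰ eval κ v))    ≡⟨ cong (eval κ u ∙ᴰ_) (∙ᴰ-assoc gˣ gˣ _) ⟨
      eval κ u ∙ᴰ (gˣ ∙ᴰ gˣ ∙ᴰ eval κ v)
        ≡⟨ cong (λ g → eval κ u ∙ᴰ (g ∙ᴰ eval κ v)) (image-involutive (κ x)) ⟩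
      eval κ u ∙ᴰ (εᴰ ∙ᴰ eval κ v)            ≡⟨ cong (eval κ u ∙ᴰ_) (∙ᴰ-identityˡ (eval κ v)) ⟩
      eval κ u ∙ᴰ eval κ v                    ≡⟨ eval-++ κ u v ⟨
      eval κ (u ++ v)                         ∎)
      where
      open ≡.≡-Reasoning
      gˣ : D∞
      gˣ = image (κ x)
    sound {k} κ relators (pe-rel u v {ρ} ρ∈) = begin
      eval κ (u ++ ρ ++ v)
        ≡⟨ ≡.trans (eval-++ κ u _) (cong (eval κ u ∙ᴰ_) (eval-++ κ ρ v)) ⟩
      eval κ u ∙ᴰ (eval κ ρ ∙ᴰ eval κ v)
        ≈⟨ ~-∙ᴰ-cong (~-refl {x = eval κ u}) (~-∙ᴰ-cong (All.lookup relators ρ∈) ~-refl) ⟩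
      eval κ u ∙ᴰ (εᴰ ∙ᴰ eval κ v)  ≡⟨ cong (eval κ u ∙ᴰ_) (∙ᴰ-identityˡ (eval κ v)) ⟩
      eval κ u ∙ᴰ eval κ v          ≡⟨ eval-++ κ u v ⟨
      eval κ (u ++ v)               ∎
      where open SetoidReasoning (Group.setoid (Dₖ k))

  ^w-snoc : ∀ (w : PWord) n → w ^w suc n ≡ w ^w n ++ w
  ^w-snoc w zero    = List.++-identityʳ w
  ^w-snoc w (suc n) = ≡.trans (cong (w ++_) (^w-snoc w n)) (≡.sym (List.++-assoc w (w ^w n) w))

  ℤ-multiples-closed : (P : ℤ → Set) → P 0ℤ → (∀ {i j} → P i → P j → P (i + j)) →
                       (∀ {i} → P i → P (- i)) → ∀ {i} → P i → ∀ c → P (c * i)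
  ℤ-multiples-closed P P0 P+ P- {i} Pi (+ n)    = ℕ-multiples n
    where
    ℕ-multiples : ∀ n → P (+ n * i)
    ℕ-multiples zero    = ≡.subst P (≡.sym (*-zeroˡ i)) P0
    ℕ-multiples (suc n) = ≡.subst P (≡.sym (*-distribʳ-+ i 1ℤ (+ n)))
      (≡.subst (λ j → P (j + + n * i)) (≡.sym (*-identityˡ i)) (P+ Pi (ℕ-multiples n)))
  ℤ-multiples-closed P P0 P+ P- {i} Pi -[1+ n ] =
    ≡.subst P (neg-distribˡ-* (+ suc n) i) (P- (ℤ-multiples-closed P P0 P+ P- Pi (+ suc n)))

  word : Gen → PWord
  word x = [ (x , true) ]

  imageWord : Gen → Gen → GenImage → PWord
  imageWord gᵃ gᵇ one = []
  imageWord gᵃ gᵇ a   = word gᵃ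
  imageWord gᵃ gᵇ b   = word gᵇ

  record PresentsDihedral (rels : List PWord) (k : ℕ) : Set where
    field
      κ        : Gen → GenImage
      gᵃ gᵇ    : Gen
      κgᵃ≡a    : κ gᵃ ≡ a
      κgᵇ≡b    : κ gᵇ ≡ b
      generator≈ : ∀ x → PresEq rels (word x) (imageWord gᵃ gᵇ (κ x))
      a²≈ε     : PresEq rels (word gᵃ ++ word gᵃ) []
      b²≈ε     : PresEq rels (word gᵇ ++ word gᵇ) []
      [ab]ᵏ≈ε  : PresEq rels ((word gᵃ ++ word gᵇ) ^w k) []
      relators : All (λ ρ → eval κ ρ ~[ k ] εᴰ) rels
      [tl]²≡ε  : eval κ (word t ++ word l ++ word t ++ word l) ≡ εᴰ

  module NormalForm {rels k} (P : PresentsDihedral rels k) where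
    open PresentsDihedral P
    open Presentation rels
    open SetoidReasoning ≈ᵖ-setoid

    A B : PWord
    A = word gᵃ
    B = word gᵇ

    -- ρʷ j spells ρʲ as (AB)ʲ or (BA)⁻ʲ, and nf (s , j) spells ρʲσˢ.
    ρʷ : ℤ → PWord
    ρʷ (+ n)    = (A ++ B) ^w n
    ρʷ -[1+ n ] = (B ++ A) ^w suc n

    nf : D∞ → PWord
    nf (false , j) = ρʷ j
    nf (true  , j) = ρʷ j ++ A

    eval-AB : eval κ (A ++ B) ≡ rot 1ℤ
    eval-AB rewrite κgᵃ≡a | κgᵇ≡b = refl

    eval-BA : eval κ (B ++ A) ≡ rot -1ℤ
    eval-BA rewrite κgᵃ≡a | κgᵇ≡b = refl

    eval-ρʷ : ∀ j → eval κ (ρʷ j) ≡ rot j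
    eval-ρʷ (+ n)    = ≡.trans (eval-^w κ {A ++ B} eval-AB n) (cong rot (*-identityˡ (+ n)))
    eval-ρʷ -[1+ n ] = ≡.trans (eval-^w κ {B ++ A} eval-BA (suc n)) (cong rot (-1*i≡-i (+ suc n)))

    cancel : ∀ u {w} → w ≈ᵖ [] → u ++ w ≈ᵖ u
    cancel u w≈ε = pe-trans (++-congˡ u w≈ε) (≡⇒≈ᵖ (List.++-identityʳ u))

    generator²≈ε : ∀ x → word x ++ word x ≈ᵖ []
    generator²≈ε x = pe-trans (++-cong (generator≈ x) (generator≈ x)) (image²≈ε (κ x))
      where
      image²≈ε : ∀ g → imageWord gᵃ gᵇ g ++ imageWord gᵃ gᵇ g ≈ᵖ []
      image²≈ε one = pe-refl
      image²≈ε a   = a²≈ε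
      image²≈ε b   = b²≈ε

    letter≈ : ∀ y → [ y ] ≈ᵖ imageWord gᵃ gᵇ (κ (proj₁ y))
    letter≈ (x , true)  = generator≈ x
    letter≈ (x , false) = pe-trans x⁻¹≈x (generator≈ x)
      where
      x⁻¹≈x : [ (x , false) ] ≈ᵖ word x
      x⁻¹≈x = pe-trans (pe-sym (cancel [ (x , false) ] (generator²≈ε x)))
                       (pe-free [] (word x) (x , false))

    ρʷ-suc : ∀ j → ρʷ j ++ A ++ B ≈ᵖ ρʷ (j + 1ℤ)
    ρʷ-suc (+ n)    = ≡⇒≈ᵖ (≡.trans (≡.sym (^w-snoc (A ++ B) n)) (cong ρʷ (+-comm 1ℤ (+ n))))
    ρʷ-suc -[1+ n ] = begin
      (B ++ A) ^w suc n ++ A ++ B          ≡⟨ cong (_++ A ++ B) (^w-snoc (B ++ A) n) ⟩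
      ((B ++ A) ^w n ++ B ++ A) ++ A ++ B  ≡⟨ List.++-assoc ((B ++ A) ^w n) (B ++ A) (A ++ B) ⟩
      (B ++ A) ^w n ++ B ++ (A ++ A) ++ B  ≈⟨ ++-congˡ _ (++-congˡ B (++-congʳ B a²≈ε)) ⟩
      (B ++ A) ^w n ++ B ++ B              ≈⟨ cancel ((B ++ A) ^w n) b²≈ε ⟩
      (B ++ A) ^w n                        ≡⟨ ρʷ-[1+n]+1 n ⟨
      ρʷ (-[1+ n ] + 1ℤ)                   ∎
      where
      ρʷ-[1+n]+1 : ∀ n → ρʷ (-[1+ n ] + 1ℤ) ≡ (B ++ A) ^w n
      ρʷ-[1+n]+1 zero    = refl
      ρʷ-[1+n]+1 (suc n) = refl

    ρʷ-pred : ∀ j → ρʷ j ++ B ≈ᵖ ρʷ (j - 1ℤ) ++ A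
    ρʷ-pred (+ zero)  = pe-sym (cancel B a²≈ε)
    ρʷ-pred (+ suc n) = begin
      (A ++ B) ^w suc n ++ B          ≡⟨ cong (_++ B) (^w-snoc (A ++ B) n) ⟩
      ((A ++ B) ^w n ++ A ++ B) ++ B  ≡⟨ List.++-assoc ((A ++ B) ^w n) (A ++ B) B ⟩
      (A ++ B) ^w n ++ A ++ B ++ B    ≈⟨ ++-congˡ ((A ++ B) ^w n) (cancel A b²≈ε) ⟩
      (A ++ B) ^w n ++ A              ∎
    ρʷ-pred -[1+ n ]  = begin
      (B ++ A) ^w suc n ++ B                ≈⟨ ++-congˡ ((B ++ A) ^w suc n) (cancel B a²≈ε) ⟨
      (B ++ A) ^w suc n ++ B ++ A ++ A      ≡⟨ List.++-assoc ((B ++ A) ^w suc n) (B ++ A) A ⟨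
      ((B ++ A) ^w suc n ++ B ++ A) ++ A    ≡⟨ cong (_++ A) (^w-snoc (B ++ A) (suc n)) ⟨
      (B ++ A) ^w suc (suc n) ++ A
        ≡⟨ cong (λ m → (B ++ A) ^w suc (suc m) ++ A) (ℕₚ.+-identityʳ n) ⟨
      ρʷ (-[1+ n ] - 1ℤ) ++ A               ∎

    nf-step : ∀ d g → nf d ++ imageWord gᵃ gᵇ g ≈ᵖ nf (d ∙ᴰ image g)
    nf-step d           one =
      ≡⇒≈ᵖ (≡.trans (List.++-identityʳ (nf d)) (cong nf (≡.sym (∙ᴰ-identityʳ d))))
    nf-step (false , j) a   = ≡⇒≈ᵖ (cong (λ i → ρʷ i ++ A) (≡.sym (+-identityʳ j)))
    nf-step (true  , j) a   = begin
      (ρʷ j ++ A) ++ A   ≡⟨ List.++-assoc (ρʷ j) A A ⟩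
      ρʷ j ++ A ++ A     ≈⟨ cancel (ρʷ j) a²≈ε ⟩
      ρʷ j               ≡⟨ cong ρʷ (+-identityʳ j) ⟨
      ρʷ (j - 0ℤ)        ∎
    nf-step (false , j) b   = ρʷ-pred j
    nf-step (true  , j) b   = pe-trans (≡⇒≈ᵖ (List.++-assoc (ρʷ j) A B)) (ρʷ-suc j)

    nf-++ : ∀ d w → nf d ++ w ≈ᵖ nf (d ∙ᴰ eval κ w)
    nf-++ d []            = nf-step d one
    nf-++ d ((x , s) ∷ w) = begin
      nf d ++ (x , s) ∷ w                       ≡⟨ List.++-assoc (nf d) [ (x , s) ] w ⟨
      (nf d ++ [ (x , s) ]) ++ w                ≈⟨ ++-congʳ w (++-congˡ (nf d) (letter≈ (x , s))) ⟩
      (nf d ++ imageWord gᵃ gᵇ (κ x)) ++ w      ≈⟨ ++-congʳ w (nf-step d (κ x)) ⟩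
      nf (d ∙ᴰ image (κ x)) ++ w                ≈⟨ nf-++ (d ∙ᴰ image (κ x)) w ⟩
      nf (d ∙ᴰ image (κ x) ∙ᴰ eval κ w)          ≡⟨ cong nf (∙ᴰ-assoc d (image (κ x)) (eval κ w)) ⟩
      nf (d ∙ᴰ (image (κ x) ∙ᴰ eval κ w))        ∎

    ≈nf-eval : ∀ w → w ≈ᵖ nf (eval κ w)
    ≈nf-eval w = pe-trans (nf-++ εᴰ w) (≡⇒≈ᵖ (cong nf (∙ᴰ-identityˡ (eval κ w))))

    ρʷ-+ : ∀ i j → ρʷ i ++ ρʷ j ≈ᵖ ρʷ (i + j)
    ρʷ-+ i j = pe-trans (nf-++ (rot i) (ρʷ j)) (≡⇒≈ᵖ (cong (λ d → nf (rot i ∙ᴰ d)) (eval-ρʷ j)))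

    ρʷ-multiple-of-k≈ε : ∀ c → ρʷ (c * + k) ≈ᵖ []
    ρʷ-multiple-of-k≈ε = ℤ-multiples-closed (λ j → ρʷ j ≈ᵖ []) pe-refl
      (λ {i} {j} ρʷi≈ε ρʷj≈ε → pe-trans (pe-sym (ρʷ-+ i j)) (pe-trans (cancel (ρʷ i) ρʷj≈ε) ρʷi≈ε))
      (λ {i} ρʷi≈ε → pe-trans (pe-sym (cancel (ρʷ (- i)) ρʷi≈ε))
                       (pe-trans (ρʷ-+ (- i) i) (≡⇒≈ᵖ (cong ρʷ (+-inverseˡ i)))))
      [ab]ᵏ≈ε

    ρʷ-resp : ∀ {i j} → + k ∣ i - j → ρʷ i ≈ᵖ ρʷ j
    ρʷ-resp {i} {j} (divides c i-j≡ck) = begin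
      ρʷ i                ≡⟨ cong ρʷ (j+[i-j]≡i i j) ⟨
      ρʷ (j + (i - j))    ≈⟨ ρʷ-+ j (i - j) ⟨
      ρʷ j ++ ρʷ (i - j)  ≡⟨ cong (λ n → ρʷ j ++ ρʷ n) i-j≡ck ⟩
      ρʷ j ++ ρʷ (c * + k) ≈⟨ cancel (ρʷ j) (ρʷ-multiple-of-k≈ε c) ⟩
      ρʷ j                ∎
      where
      j+[i-j]≡i : ∀ i j → j + (i - j) ≡ i
      j+[i-j]≡i = solve-∀

    nf-resp : ∀ {x y} → x ~[ k ] y → nf x ≈ᵖ nf y
    nf-resp {false , i} {_ , j} (same k∣i-j) = ρʷ-resp {i} {j} k∣i-j
    nf-resp {true  , i} {_ , j} (same k∣i-j) = ++-congʳ A (ρʷ-resp {i} {j} k∣i-j)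

    complete : ∀ {u v} → eval κ u ~[ k ] eval κ v → u ≈ᵖ v
    complete {u} {v} eval-u~eval-v =
      pe-trans (≈nf-eval u) (pe-trans (nf-resp eval-u~eval-v) (pe-sym (≈nf-eval v)))

  module PresentedDihedral {rels k} (P : PresentsDihedral rels k) where
    open PresentsDihedral P
    open Presentation rels
    open NormalForm P

    _≈ᵖ?_ : ∀ u v → Dec (u ≈ᵖ v)
    u ≈ᵖ? v = map′ complete (sound κ relators) (eval κ u ~?[ k ] eval κ v)

    eval-homomorphism : ∀ {m} → + m ∣ + k →
                        IsGroupHomomorphism presentedRawGroup (Group.rawGroup (Dₖ m)) (eval κ)
    eval-homomorphism m∣k = record
      { isMonoidHomomorphism = record
        { isMagmaHomomorphism = record
          { isRelHomomorphism = record { cong = λ u≈v → ~-weaken m∣k (sound κ relators u≈v) }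
          ; homo = λ u v → ~-reflexive (eval-++ κ u v) }
        ; ε-homo = ~-refl }
      ; ⁻¹-homo = λ w → ~-reflexive (eval-pinv κ w) }

    presentedGroup : Group 0ℓ 0ℓ
    presentedGroup = record
      { Carrier = PWord ; _≈_ = _≈ᵖ_ ; _∙_ = _++_ ; ε = [] ; _⁻¹ = pinv
      ; isGroup = GroupMonomorphism.isGroup
          (record { isGroupHomomorphism = eval-homomorphism ∣-refl ; injective = complete })
          (Dₖ-isGroup k)
      }

    open Regular presentedGroup (word t) (word l) (word r)

    isMap : .{{NonZero k}} → IsMap M
    isMap = regular-isMap (generator²≈ε t) (generator²≈ε l) (generator²≈ε r)
      (complete (~-reflexive [tl]²≡ε))
      (λ w → map proj₁ w , complete (~-reflexive (eval-f-map-proj₁ w)))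
      (let (n , e , cover) = Dₖ-finite k
       in n , nf ∘ e , λ w → let (i , eᵢ~w) = cover (eval κ w)
                             in i , pe-trans (nf-resp eᵢ~w) (pe-sym (≈nf-eval w)))
      where
      eval-f-map-proj₁ : ∀ w → eval κ (MapData.f M (map proj₁ w)) ≡ eval κ w
      eval-f-map-proj₁ []            = refl
      eval-f-map-proj₁ ((t , _) ∷ w) = cong (image (κ t) ∙ᴰ_) (eval-f-map-proj₁ w)
      eval-f-map-proj₁ ((l , _) ∷ w) = cong (image (κ l) ∙ᴰ_) (eval-f-map-proj₁ w)
      eval-f-map-proj₁ ((r , _) ∷ w) = cong (image (κ r) ∙ᴰ_) (eval-f-map-proj₁ w)

    ker : ℕ → Pred PWord 0ℓ
    ker m w = eval κ w ~[ m ] εᴰ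

    ker-normal : ∀ {m} → + m ∣ + k → IsNormalSubgroup M (ker m)
    ker-normal {m} m∣k = kernel-normal {Dₖ m} (eval-homomorphism m∣k)

    ρʷ∈ker⇔∣ : ∀ {m} j → ker m (ρʷ j) ⇔ + m ∣ j
    ρʷ∈ker⇔∣ {m} j = ≡.subst (λ d → d ~[ m ] εᴰ ⇔ + m ∣ j) (≡.sym (eval-ρʷ j)) rot~ε⇔∣

    coprimeSplit⇒splitting : CoprimeSplit k → NormalSplitting
    coprimeSplit⇒splitting (m , n , 1<m , 1<n , m⊥n , m*n≡k) = record
      { H₁ = ker m
      ; H₂ = ker n
      ; H₁-normal = ker-normal (∣ᵤ⇒∣ (ℕ∣.divides n (≡.trans (≡.sym m*n≡k) (ℕₚ.*-comm m n))))
      ; H₂-normal = ker-normal (∣ᵤ⇒∣ (ℕ∣.divides m (≡.sym m*n≡k)))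
      ; ∩-trivial = λ (w∈ker-m , w∈ker-n) → complete {v = []} (~-lcm m∣∧n∣⇒k∣ w∈ker-m w∈ker-n)
      ; H₁⊈H₂ = λ ker-m⊆ker-n →
          coprime⇒ρʷ∉ker 1<n m⊥n (ker-m⊆ker-n {ρʷ (+ m)} (ρʷ[x]∈ker[x] m))
      ; H₂⊈H₁ = λ ker-n⊆ker-m →
          coprime⇒ρʷ∉ker 1<m (Coprime.sym m⊥n) (ker-n⊆ker-m {ρʷ (+ n)} (ρʷ[x]∈ker[x] n))
      }
      where
      m∣∧n∣⇒k∣ : ∀ {z} → + m ∣ z → + n ∣ z → + k ∣ z
      m∣∧n∣⇒k∣ {z} m∣z n∣z =
        ∣ᵤ⇒∣ (≡.subst (ℕ∣._∣ ℤ.∣ z ∣) m*n≡k (coprime⇒*∣ m⊥n (∣⇒∣ᵤ m∣z) (∣⇒∣ᵤ n∣z)))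
      ρʷ[x]∈ker[x] : ∀ x → ker x (ρʷ (+ x))
      ρʷ[x]∈ker[x] x = from (ρʷ∈ker⇔∣ (+ x)) ∣-refl
      coprime⇒ρʷ∉ker : ∀ {x y} → 1 < x → Coprime y x → ¬ ker x (ρʷ (+ y))
      coprime⇒ρʷ∉ker {x} {y} 1<x y⊥x ρʷ[y]∈ker =
        ℕₚ.<⇒≢ 1<x (≡.sym (y⊥x (∣⇒∣ᵤ (to (ρʷ∈ker⇔∣ (+ y)) ρʷ[y]∈ker) , ℕ∣.∣-refl)))

    module _ {H} (normal : IsNormalSubgroup M H) where
      open IsNormalSubgroup normal

      H-eval : ∀ {u v} → eval κ u ≡ eval κ v → H u → H v
      H-eval eval-u≡eval-v = H-resp (complete (~-reflexive eval-u≡eval-v))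

      ρʷ-neg : ∀ {i} → H (ρʷ i) → H (ρʷ (- i))
      ρʷ-neg {i} ρʷi∈H = H-eval
        (≡.trans (eval-pinv κ (ρʷ i)) (≡.trans (cong _⁻¹ᴰ (eval-ρʷ i)) (≡.sym (eval-ρʷ (- i)))))
        (H-⁻¹ ρʷi∈H)

      ρʷ-multiples : ∀ {i} → H (ρʷ i) → ∀ c → H (ρʷ (c * i))
      ρʷ-multiples = ℤ-multiples-closed (λ j → H (ρʷ j)) H-ε
        (λ {i} {j} ρʷi∈H ρʷj∈H → H-resp (ρʷ-+ i j) (H-∙ ρʷi∈H ρʷj∈H)) (λ {i} → ρʷ-neg {i})

      -- A reflection times its conjugate by ρ is ρ².
      reflection⇒ρ² : ∀ {g j} → H g → eval κ g ≡ ref j → H (ρʷ (+ 2))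
      reflection⇒ρ² {g} {j} g∈H eval-g = H-eval eval≡ (H-∙ g∈H (H-conj (A ++ B) g∈H))
        where
        open ≡.≡-Reasoning
        eval≡ : eval κ (g ++ (pinv (A ++ B) ++ g) ++ A ++ B) ≡ eval κ (ρʷ (+ 2))
        eval≡ = begin
          eval κ (g ++ (pinv (A ++ B) ++ g) ++ A ++ B)
            ≡⟨ ≡.trans (eval-++ κ g _) (cong (eval κ g ∙ᴰ_)
                 (≡.trans (eval-++ κ (pinv (A ++ B) ++ g) _)
                          (cong (_∙ᴰ eval κ (A ++ B)) (eval-++ κ (pinv (A ++ B)) g)))) ⟩
          eval κ g ∙ᴰ (eval κ (pinv (A ++ B)) ∙ᴰ eval κ g ∙ᴰ eval κ (A ++ B))
            ≡⟨ cong₂ (λ x y → x ∙ᴰ (y ∙ᴰ x ∙ᴰ eval κ (A ++ B))) eval-g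
                 (≡.trans (eval-pinv κ (A ++ B)) (cong _⁻¹ᴰ eval-AB)) ⟩
          ref j ∙ᴰ (rot -1ℤ ∙ᴰ ref j ∙ᴰ eval κ (A ++ B))
            ≡⟨ cong (λ x → ref j ∙ᴰ (rot -1ℤ ∙ᴰ ref j ∙ᴰ x)) eval-AB ⟩
          ref j ∙ᴰ (rot -1ℤ ∙ᴰ ref j ∙ᴰ rot 1ℤ)
            ≡⟨ cong rot (j-[-1+j-1]≡2 j) ⟩
          rot (+ 2)
            ≡⟨ eval-ρʷ (+ 2) ⟨
          eval κ (ρʷ (+ 2)) ∎
          where
          j-[-1+j-1]≡2 : ∀ j → j - ((- + 1 + j) - + 1) ≡ + 2
          j-[-1+j-1]≡2 = solve-∀

      module _ {p e} (p-prime : Prime p) (k≡p^[1+e] : k ≡ p ℕ.^ suc e) where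

        rotation⇒ρ^[p^e] : ∀ {j} → H (ρʷ j) → ¬ + k ∣ j → H (ρʷ (+ (p ℕ.^ e)))
        rotation⇒ρ^[p^e] {j} ρʷj∈H k∤j =
          let (c , k∣c∣j∣-p^e) = prime-power-congruence p-prime e k≡p^[1+e] ℤ.∣ j ∣ (k∤j ∘ ∣ᵤ⇒∣)
          in H-resp (ρʷ-resp {c * + ℤ.∣ j ∣} k∣c∣j∣-p^e) (ρʷ-multiples (ρʷ∣j∣∈H j ρʷj∈H) c)
          where
          ρʷ∣j∣∈H : ∀ j → H (ρʷ j) → H (ρʷ (+ ℤ.∣ j ∣))
          ρʷ∣j∣∈H (+ n)    ρʷj∈H = ρʷj∈H
          ρʷ∣j∣∈H -[1+ n ] ρʷj∈H = ρʷ-neg { -[1+ n ]} ρʷj∈H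

        nontrivial⇒ρ^[p^e] : 2 < k → ∀ {g} → H g → ¬ g ≈ᵖ [] → H (ρʷ (+ (p ℕ.^ e)))
        nontrivial⇒ρ^[p^e] 2<k {g} g∈H g≉ε with eval κ g in eval-g
        ... | false , j = rotation⇒ρ^[p^e] (H-eval (≡.trans eval-g (≡.sym (eval-ρʷ j))) g∈H)
          λ k∣j → g≉ε (complete {v = []} (≡.subst (_~[ k ] εᴰ) (≡.sym eval-g) (from rot~ε⇔∣ k∣j)))
        -- Only here is k > 2 needed: in D₂ the rotation ρ² is trivial.
        ... | true  , j = rotation⇒ρ^[p^e] {+ 2} (reflection⇒ρ² g∈H eval-g)
          λ k∣2 → ℕₚ.<⇒≱ 2<k (ℕ∣.∣⇒≤ (∣⇒∣ᵤ k∣2))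

        ρ^[p^e]∉⇒trivial : 2 < k → ¬ H (ρʷ (+ (p ℕ.^ e))) → H ⊆ (_≈ᵖ [])
        ρ^[p^e]∉⇒trivial 2<k ρ^[p^e]∉H {g} g∈H with g ≈ᵖ? []
        ... | yes g≈ε = g≈ε
        ... | no  g≉ε = ⊥-elim (ρ^[p^e]∉H (nontrivial⇒ρ^[p^e] 2<k g∈H g≉ε))

    ρ^[p^e]≉ε : ∀ {p e} → Prime p → k ≡ p ℕ.^ suc e → ¬ ρʷ (+ (p ℕ.^ e)) ≈ᵖ []
    ρ^[p^e]≉ε {p} {e} p-prime k≡p^[1+e] ρ^[p^e]≈ε = p^[1+e]∤p^e p-prime e
      (≡.subst (ℕ∣._∣ p ℕ.^ e) k≡p^[1+e]
        (∣⇒∣ᵤ (to (ρʷ∈ker⇔∣ {k} (+ (p ℕ.^ e))) (sound κ relators ρ^[p^e]≈ε))))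

    splitting⇒¬primePower : 2 < k → NormalSplitting → ¬ IsPrimePower k
    splitting⇒¬primePower 2<k splitting (p , suc e , p-prime , _ , k≡p^[1+e]) =
      ρ^[p^e]∈ H₁-normal H₂-normal H₁⊈H₂ λ ρ^[p^e]∈H₁ →
      ρ^[p^e]∈ H₂-normal H₁-normal H₂⊈H₁ λ ρ^[p^e]∈H₂ →
      ρ^[p^e]≉ε {p} {e} p-prime k≡p^[1+e] (∩-trivial (ρ^[p^e]∈H₁ , ρ^[p^e]∈H₂))
      where
      open NormalSplitting splitting
      ρ^[p^e]∈ : ∀ {H H′} → IsNormalSubgroup M H → IsNormalSubgroup M H′ → ¬ H ⊆ H′ →
                 ¬ ¬ H (ρʷ (+ (p ℕ.^ e)))
      ρ^[p^e]∈ normal normal′ H⊈H′ ρ^[p^e]∉H = H⊈H′ λ g∈H →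
        Quotient.≈ε⇒∈ normal′ (ρ^[p^e]∉⇒trivial normal {p} {e} p-prime k≡p^[1+e] 2<k ρ^[p^e]∉H g∈H)

    decomposable⇔¬primePower : 2 < k → ParallelProductDecomposable M ⇔ (¬ IsPrimePower k)
    decomposable⇔¬primePower 2<k = ⇔.trans (decomposable⇔splitting isMap)
      (mk⇔ (splitting⇒¬primePower 2<k) (coprimeSplit⇒splitting ∘ ¬IsPrimePower⇒CoprimeSplit 1<k))
      where
      1<k : 1 < k
      1<k = ℕₚ.<-trans (ℕ.s<s ℕ.z<s) 2<k
      instance
        k≢0 : NonZero k
        k≢0 = ℕ.>-nonZero (ℕₚ.<-trans ℕ.z<s 1<k)

  -- DMrels lists the relators of T, L, R, TL, TR, LR, TLR in this order; gᵃ and gᵇ are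
  -- chosen so that (gᵃgᵇ)ᵏ is one of them.
  κ₆ κ₇ κ₈ : Gen → GenImage
  κ₆ t = a
  κ₆ l = one
  κ₆ r = b
  κ₇ t = one
  κ₇ l = a
  κ₇ r = b
  κ₈ t = a
  κ₈ l = a
  κ₈ r = b

  DM₆-presents : ∀ k → PresentsDihedral (DMrels 2 1 2 2 k 2 k) k
  DM₆-presents k = record
    { κ = κ₆ ; gᵃ = t ; gᵇ = r ; κgᵃ≡a = refl ; κgᵇ≡b = refl
    ; generator≈ = λ { t → pe-refl ; l → relator≈ε (there (here refl)) ; r → pe-refl }
    ; a²≈ε = relator≈ε (here refl)
    ; b²≈ε = relator≈ε (there (there (here refl)))
    ; [ab]ᵏ≈ε = relator≈ε (there (there (there (there (here refl)))))
    ; relators = ~-refl ∷ ~-refl ∷ ~-refl ∷ ~-refl ∷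
                 eval-^w~ε κ₆ refl k ∷ ~-refl ∷ eval-^w~ε κ₆ refl k ∷ []
    ; [tl]²≡ε = refl
    }
    where open Presentation (DMrels 2 1 2 2 k 2 k)

  DM₇-presents : ∀ k → PresentsDihedral (DMrels 1 2 2 2 2 k k) k
  DM₇-presents k = record
    { κ = κ₇ ; gᵃ = l ; gᵇ = r ; κgᵃ≡a = refl ; κgᵇ≡b = refl
    ; generator≈ = λ { t → relator≈ε (here refl) ; l → pe-refl ; r → pe-refl }
    ; a²≈ε = relator≈ε (there (here refl))
    ; b²≈ε = relator≈ε (there (there (here refl)))
    ; [ab]ᵏ≈ε = relator≈ε (there (there (there (there (there (here refl))))))
    ; relators = ~-refl ∷ ~-refl ∷ ~-refl ∷ ~-refl ∷
                 ~-refl ∷ eval-^w~ε κ₇ refl k ∷ eval-^w~ε κ₇ refl k ∷ []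
    ; [tl]²≡ε = refl
    }
    where open Presentation (DMrels 1 2 2 2 2 k k)

  DM₈-presents : ∀ k → PresentsDihedral (DMrels 2 2 2 1 k k 2) k
  DM₈-presents k = record
    { κ = κ₈ ; gᵃ = t ; gᵇ = r ; κgᵃ≡a = refl ; κgᵇ≡b = refl
    ; generator≈ = λ { t → pe-refl ; l → l≈t ; r → pe-refl }
    ; a²≈ε = relator≈ε (here refl)
    ; b²≈ε = relator≈ε (there (there (here refl)))
    ; [ab]ᵏ≈ε = relator≈ε (there (there (there (there (here refl)))))
    ; relators = ~-refl ∷ ~-refl ∷ ~-refl ∷ ~-refl ∷
                 eval-^w~ε κ₈ refl k ∷ eval-^w~ε κ₈ refl k ∷ ~-refl ∷ []
    ; [tl]²≡ε = refl
    }
    where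
    open Presentation (DMrels 2 2 2 1 k k 2)
    l≈t : word l ≈ᵖ word t
    l≈t = pe-trans (pe-sym (++-congʳ (word l) (relator≈ε (here refl))))
                   (++-congˡ (word t) (relator≈ε (there (there (there (here refl))))))

open Dihedral using (module PresentedDihedral; DM₆-presents; DM₇-presents; DM₈-presents)

-- DMᵢ k is by definition the regular map of the group presented by its relators.
proposition17 : ∀ (k : ℕ) → 2 < k →
    (ParallelProductDecomposable (DM₆ k) ⇔ (¬ IsPrimePower k)) ×
    (ParallelProductDecomposable (DM₇ k) ⇔ (¬ IsPrimePower k)) ×
    (ParallelProductDecomposable (DM₈ k) ⇔ (¬ IsPrimePower k))
proposition17 k 2<k =
  PresentedDihedral.decomposable⇔¬primePower (DM₆-presents k) 2<k ,
  PresentedDihedral.decomposable⇔¬primePower (DM₇-presents k) 2<k ,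
  PresentedDihedral.decomposable⇔¬primePower (DM₈-presents k) 2<k
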